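{- Let $n\geq1$ be an integer and $p\geq 3$ a prime. Let $H$ be a subgroup of $\mathrm{GL}_2(\mathbb{Z}/p^{n+1}\mathbb{Z})$ with $\det(H)=(\mathbb{Z}/p^{n+1}\mathbb{Z})^\times$. Then the restriction of $\det$ to $H\cap(1+p^n\mathrm{M}_2(\mathbb{Z}/p^{n+1}\mathbb{Z}))$ is a surjection onto $1+p^n\mathbb{Z}/p^{n+1}\mathbb{Z}$. -}

module Defs where

open import Data.Nat using (ℕ)
open import Data.Integer using (ℤ; +_; _-_; _*_; _+_; 0ℤ; 1ℤ)
open import Data.Integer.Divisibility using (_∣_)
open import Data.Product using (_×_; ∃; _,_)

-- Congruence of integers modulo a natural number m: elements of ℤ/mℤ are
-- represented by integers, equality in ℤ/mℤ is this congruence.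
infix 4 _≡_[mod_] _≋_[mod_]
_≡_[mod_] : ℤ → ℤ → ℕ → Set
a ≡ b [mod m ] = (+ m) ∣ (a - b)

record M2 : Set where
  constructor mat
  field
    a b c d : ℤ
open M2 public

I₂ : M2
I₂ = mat 1ℤ 0ℤ 0ℤ 1ℤ

_⊗_ : M2 → M2 → M2
mat a₁ b₁ c₁ d₁ ⊗ mat a₂ b₂ c₂ d₂ =
  mat (a₁ * a₂ + b₁ * c₂) (a₁ * b₂ + b₁ * d₂)
      (c₁ * a₂ + d₁ * c₂) (c₁ * b₂ + d₁ * d₂)

det : M2 → ℤ
det (mat a b c d) = a * d - b * c

-- entrywise congruence of matrices modulo m (equality in M₂(ℤ/mℤ))
_≋_[mod_] : M2 → M2 → ℕ → Set
g ≋ h [mod m ] =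
  (a g ≡ a h [mod m ]) × (b g ≡ b h [mod m ]) ×
  (c g ≡ c h [mod m ]) × (d g ≡ d h [mod m ])

IsUnit : ℕ → ℤ → Set
IsUnit m x = ∃ λ y → x * y ≡ 1ℤ [mod m ]

InGL2 : ℕ → M2 → Set
InGL2 m g = IsUnit m (det g)

record IsSubgroupGL2 (m : ℕ) (H : M2 → Set) : Set where
  field
    wellDefined : ∀ {g h} → g ≋ h [mod m ] → H g → H h
    inGL2       : ∀ {g} → H g → InGL2 m g
    hasOne      : H I₂
    mulClosed   : ∀ {g h} → H g → H h → H (g ⊗ h)
    invClosed   : ∀ {g} → H g → ∃ λ h → H h × (g ⊗ h) ≋ I₂ [mod m ]

-- Write q = pⁿ.  It suffices to find g ∈ H with g ≡ I₂ (mod q) and det g ≢ 1 (mod p q):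
-- then det g = 1 + u q with p ∤ u, and det (gʲ) ≡ 1 + j u q (mod p q) takes every value
-- x ≡ 1 (mod q).  Such a g is h^(pⁿ⁻¹) for any h ∈ H with h ≡ I₂ (mod p) and
-- det h ≢ 1 (mod p²): for odd p, raising to the p-th power improves g ≡ I₂ (mod pᵏ) to
-- gᵖ ≡ I₂ (mod pᵏ⁺¹) and raises the exact power of p dividing det g − 1 by one.
--
-- To find h, take B, A ∈ H with det B a non-square and det A ≡ 1 + p.  Then B and B A have
-- discriminants prime to p, so modulo p they live in the reduced ring 𝔽_p[X], where
-- Frobenius shows that there are no nontrivial p-th roots of unity; hence they have
-- orders m₁, m₂ prime to p.  With M = m₁ m₂, both Bᴹ and (B A)ᴹ are ≡ I₂ (mod p), and
-- their determinants differ by the factor (det A)ᴹ ≡ 1 + M p (mod p²), so one of them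
-- can serve as h.

module Submission where

open import Algebra.Bundles using (CommutativeSemiring)
open import Algebra.Structures.Biased using (IsCommutativeSemiringˡ)
open import Data.Empty using (⊥-elim)
open import Data.Fin as Fin using (Fin; toℕ; fromℕ<; combine)
import Data.Fin.Properties as Finₚ
open import Data.Integer as ℤ using (ℤ; +_; -_; _+_; _-_; _*_; _^_; 0ℤ; 1ℤ; -[1+_])
import Data.Integer.Properties as ℤₚ
open import Data.Integer.DivMod using (_%_; _/_; a≡a%n+[a/n]*n; n%d<d)
open import Data.Integer.Divisibility.Signed
open import Data.Integer.Tactic.RingSolver using (solve-∀)
open import Data.Nat as ℕ using (ℕ; zero; suc; z≤n; s≤s; _∸_; NonZero)
import Data.Nat.Properties as ℕₚ
import Data.Nat.Divisibility as ℕ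
open import Data.Nat.Combinatorics using (_C_; nCk+nC[k+1]≡[n+1]C[k+1]; k>n⇒nCk≡0; nC1≡n; nCn≡1)
open import Data.Nat.Coprimality using (Coprime; coprime-Bézout)
open import Data.Nat.GCD using (module Bézout)
open import Data.Nat.Induction using (<-rec)
open import Data.Nat.Primality
  using (Prime; euclidsLemma; prime⇒irreducible; prime⇒nonZero; prime⇒nonTrivial; ¬prime[1])
open import Data.Nat.Tactic.RingSolver using () renaming (solve-∀ to ℕ-solve-∀)
open import Data.Product using (∃; _×_; _,_; proj₁; proj₂)
open import Data.Sum using (_⊎_; inj₁; inj₂; [_,_]′)
open import Data.Vec.Functional using (Vector; init; last; tail)
open import Function using (id; _∘_)
open import Function.Definitions using (Injective)
open import Level using (0ℓ)
open import Relation.Binary.Bundles using (Setoid)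
open import Relation.Binary.PropositionalEquality
  using (_≡_; refl; sym; trans; cong; cong₂; subst; isEquivalence; module ≡-Reasoning)
import Relation.Binary.Reasoning.Setoid as ≈-Reasoning
open import Relation.Binary.Structures using (IsEquivalence)
open import Relation.Nullary using (¬_; yes; no; Dec)
import Relation.Nullary.Decidable as Dec

open import Defs

-- Congruences modulo an integer

*-pres-∣ : ∀ {i j x y} → i ∣ x → j ∣ y → i * j ∣ x * y
*-pres-∣ {i} {j} (divides a refl) (divides b refl) = divides (a * b) (rearrange a i b j)
  where
  rearrange : ∀ a i b j → a * i * (b * j) ≡ a * b * (i * j)
  rearrange = solve-∀

pos-^ : ∀ m k → + (m ℕ.^ k) ≡ (+ m) ^ k
pos-^ m zero    = refl
pos-^ m (suc k) = trans (ℤₚ.pos-* m (m ℕ.^ k)) (cong (+ m *_) (pos-^ m k))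

^-distribʳ-* : ∀ x y n → (x * y) ^ n ≡ x ^ n * y ^ n
^-distribʳ-* x y zero    = refl
^-distribʳ-* x y (suc n) = trans (cong (x * y *_) (^-distribʳ-* x y n)) (swap x y (x ^ n) (y ^ n))
  where
  swap : ∀ a b c d → a * b * (c * d) ≡ a * c * (b * d)
  swap = solve-∀

^-monoʳ-∣ : ∀ x {i j} → i ℕ.≤ j → x ^ i ∣ x ^ j
^-monoʳ-∣ x {i} i≤j =
  let o , i+o≡j = ℕₚ.m≤n⇒∃[o]m+o≡n i≤j
  in divides (x ^ o) (trans (cong (x ^_) (sym i+o≡j)) (trans (ℤₚ.^-distribˡ-+-* x i o) (ℤₚ.*-comm (x ^ i) (x ^ o))))

infix 4 _≡_⟨mod_⟩
-- A record rather than a synonym for k ∣ x - y, so that x and y can be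
-- recovered from the type.
record _≡_⟨mod_⟩ (x y k : ℤ) : Set where
  constructor congruence
  field ∣-difference : k ∣ x - y
open _≡_⟨mod_⟩ public

module _ {k : ℤ} where

  ≡-mod-by : ∀ {x y z} → x - y ≡ z → k ∣ z → x ≡ y ⟨mod k ⟩
  ≡-mod-by refl k∣z = congruence k∣z

  ≡⇒≡-mod : ∀ {x y} → x ≡ y → x ≡ y ⟨mod k ⟩
  ≡⇒≡-mod {x} refl = ≡-mod-by (ℤₚ.+-inverseʳ x) (divides 0ℤ (sym (ℤₚ.*-zeroˡ k)))

  ≡-mod-refl : ∀ {x} → x ≡ x ⟨mod k ⟩
  ≡-mod-refl = ≡⇒≡-mod refl

  ≡-mod-sym : ∀ {x y} → x ≡ y ⟨mod k ⟩ → y ≡ x ⟨mod k ⟩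
  ≡-mod-sym {x} {y} (congruence k∣x-y) = ≡-mod-by (negate x y) (∣m⇒∣-m k∣x-y)
    where
    negate : ∀ x y → y - x ≡ - (x - y)
    negate = solve-∀

  ≡-mod-trans : ∀ {x y z} → x ≡ y ⟨mod k ⟩ → y ≡ z ⟨mod k ⟩ → x ≡ z ⟨mod k ⟩
  ≡-mod-trans {x} {y} {z} (congruence k∣x-y) (congruence k∣y-z) =
    ≡-mod-by (telescope x y z) (∣m∣n⇒∣m+n k∣x-y k∣y-z)
    where
    telescope : ∀ x y z → x - z ≡ (x - y) + (y - z)
    telescope = solve-∀

  ≡-mod-isEquivalence : IsEquivalence _≡_⟨mod k ⟩
  ≡-mod-isEquivalence = record { refl = ≡-mod-refl ; sym = ≡-mod-sym ; trans = ≡-mod-trans }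

  ∣⇒≡-mod-0 : ∀ {x} → k ∣ x → x ≡ 0ℤ ⟨mod k ⟩
  ∣⇒≡-mod-0 {x} = ≡-mod-by (ℤₚ.+-identityʳ x)

  ≡-mod-0⇒∣ : ∀ {x} → x ≡ 0ℤ ⟨mod k ⟩ → k ∣ x
  ≡-mod-0⇒∣ {x} (congruence k∣x-0) = subst (k ∣_) (ℤₚ.+-identityʳ x) k∣x-0

  +-cong : ∀ {x x′ y y′} → x ≡ x′ ⟨mod k ⟩ → y ≡ y′ ⟨mod k ⟩ → x + y ≡ x′ + y′ ⟨mod k ⟩
  +-cong {x} {x′} {y} {y′} (congruence k∣x) (congruence k∣y) =
    ≡-mod-by (regroup x x′ y y′) (∣m∣n⇒∣m+n k∣x k∣y)
    where
    regroup : ∀ x x′ y y′ → (x + y) - (x′ + y′) ≡ (x - x′) + (y - y′)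
    regroup = solve-∀

  -‿cong : ∀ {x x′} → x ≡ x′ ⟨mod k ⟩ → - x ≡ - x′ ⟨mod k ⟩
  -‿cong {x} {x′} (congruence k∣x) = ≡-mod-by (negate x x′) (∣m⇒∣-m k∣x)
    where
    negate : ∀ x x′ → - x - - x′ ≡ - (x - x′)
    negate = solve-∀

  *-cong : ∀ {x x′ y y′} → x ≡ x′ ⟨mod k ⟩ → y ≡ y′ ⟨mod k ⟩ → x * y ≡ x′ * y′ ⟨mod k ⟩
  *-cong {x} {x′} {y} {y′} (congruence k∣x) (congruence k∣y) =
    ≡-mod-by (regroup x x′ y y′) (∣m∣n⇒∣m+n (∣m⇒∣m*n y k∣x) (∣n⇒∣m*n x′ k∣y))
    where
    regroup : ∀ x x′ y y′ → x * y - x′ * y′ ≡ (x - x′) * y + x′ * (y - y′)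
    regroup = solve-∀

  *-congˡ : ∀ x {y y′} → y ≡ y′ ⟨mod k ⟩ → x * y ≡ x * y′ ⟨mod k ⟩
  *-congˡ x = *-cong (≡-mod-refl {x})

  *-congʳ : ∀ {x x′} y → x ≡ x′ ⟨mod k ⟩ → x * y ≡ x′ * y ⟨mod k ⟩
  *-congʳ y x≡x′ = *-cong x≡x′ (≡-mod-refl {y})

  ^-cong : ∀ {x x′} n → x ≡ x′ ⟨mod k ⟩ → x ^ n ≡ x′ ^ n ⟨mod k ⟩
  ^-cong zero    _   = ≡-mod-refl
  ^-cong (suc n) x≡x′ = *-cong x≡x′ (^-cong n x≡x′)

x+y*k≡x : ∀ {k} x y → x + y * k ≡ x ⟨mod k ⟩
x+y*k≡x {k} x y = ≡-mod-by (cancel x (y * k)) (∣n⇒∣m*n y ∣-refl)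
  where
  cancel : ∀ x z → x + z - x ≡ z
  cancel = solve-∀

+-cancelʳ-≡-mod : ∀ {k x y} z → x + z ≡ y + z ⟨mod k ⟩ → x ≡ y ⟨mod k ⟩
+-cancelʳ-≡-mod {k} {x} {y} z (congruence k∣diff) = ≡-mod-by (sym (cancel x y z)) k∣diff
  where
  cancel : ∀ x y z → (x + z) - (y + z) ≡ x - y
  cancel = solve-∀

≡-mod-setoid : ℤ → Setoid 0ℓ 0ℓ
≡-mod-setoid k = record { isEquivalence = ≡-mod-isEquivalence {k} }

module ≡-mod-Reasoning (k : ℤ) = ≈-Reasoning (≡-mod-setoid k)

≡-mod-∣ : ∀ {k k′ x y} → k ∣ k′ → x ≡ y ⟨mod k′ ⟩ → x ≡ y ⟨mod k ⟩
≡-mod-∣ k∣k′ (congruence k′∣x-y) = congruence (∣-trans k∣k′ k′∣x-y)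

≡-mod? : ∀ k x y → Dec (x ≡ y ⟨mod k ⟩)
≡-mod? k x y = Dec.map′ congruence ∣-difference (k ∣? x - y)

[mod]⇒⟨mod⟩ : ∀ {m x y} → x ≡ y [mod m ] → x ≡ y ⟨mod + m ⟩
[mod]⇒⟨mod⟩ m∣x-y = congruence (∣ᵤ⇒∣ m∣x-y)

⟨mod⟩⇒[mod] : ∀ {m x y} → x ≡ y ⟨mod + m ⟩ → x ≡ y [mod m ]
⟨mod⟩⇒[mod] (congruence m∣x-y) = ∣⇒∣ᵤ m∣x-y

[x%k]≡x : ∀ x k .{{_ : ℤ.NonZero k}} → + (x % k) ≡ x ⟨mod k ⟩
[x%k]≡x x k = ≡-mod-by (trans (cong (λ t → + (x % k) - t) (a≡a%n+[a/n]*n x k)) (cancel (+ (x % k)) (x / k) k))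
                       (∣n⇒∣m*n (- (x / k)) ∣-refl)
  where
  cancel : ∀ r d k → r - (r + d * k) ≡ - d * k
  cancel = solve-∀

module _ {p : ℕ} .{{_ : NonZero p}} where

  residue : ℤ → Fin p
  residue x = fromℕ< (n%d<d x (+ p))

  residue≡x : ∀ x → + toℕ (residue x) ≡ x ⟨mod + p ⟩
  residue≡x x = subst (λ r → + r ≡ x ⟨mod + p ⟩) (sym (Finₚ.toℕ-fromℕ< (n%d<d x (+ p)))) ([x%k]≡x x (+ p))

  residue-≡-mod : ∀ x y → residue x ≡ residue y → x ≡ y ⟨mod + p ⟩
  residue-≡-mod x y eq = ≡-mod-trans (≡-mod-sym (residue≡x x)) (subst (λ r → + toℕ r ≡ y ⟨mod + p ⟩) (sym eq) (residue≡x y))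

-- Primes and units

module _ {p : ℕ} (p-prime : Prime p) where

  prime∣*⇒∣⊎∣ : ∀ x y → + p ∣ x * y → + p ∣ x ⊎ + p ∣ y
  prime∣*⇒∣⊎∣ x y p∣xy
    with euclidsLemma ℤ.∣ x ∣ ℤ.∣ y ∣ p-prime (subst (p ℕ.∣_) (ℤₚ.abs-* x y) (∣⇒∣ᵤ p∣xy))
  ... | inj₁ p∣x = inj₁ (∣ᵤ⇒∣ p∣x)
  ... | inj₂ p∣y = inj₂ (∣ᵤ⇒∣ p∣y)

  prime∣x*x⇒∣x : ∀ x → + p ∣ x * x → + p ∣ x
  prime∣x*x⇒∣x x p∣xx = [ id , id ]′ (prime∣*⇒∣⊎∣ x x p∣xx)

  prime∣^⇒∣ : ∀ x n → + p ∣ x ^ n → + p ∣ x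
  prime∣^⇒∣ x zero    p∣1 = ⊥-elim (¬prime[1] (subst Prime (ℕ.∣1⇒≡1 (∣⇒∣ᵤ p∣1)) p-prime))
  prime∣^⇒∣ x (suc n) p∣xⁿ⁺¹ with prime∣*⇒∣⊎∣ x (x ^ n) p∣xⁿ⁺¹
  ... | inj₁ p∣x  = p∣x
  ... | inj₂ p∣xⁿ = prime∣^⇒∣ x n p∣xⁿ

  private
    coprime : ∀ {m} → ¬ (p ℕ.∣ m) → Coprime p m
    coprime p∤m (d∣p , d∣m) with prime⇒irreducible p-prime d∣p
    ... | inj₁ d≡1 = d≡1
    ... | inj₂ refl = ⊥-elim (p∤m d∣m)

    pos-Bézout : ∀ a b c d → 1 ℕ.+ a ℕ.* b ≡ c ℕ.* d → 1ℤ + + a * + b ≡ + c * + d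
    pos-Bézout a b c d eq =
      trans (cong (λ s → 1ℤ + s) (sym (ℤₚ.pos-* a b)))
        (trans (sym (ℤₚ.pos-+ 1 (a ℕ.* b))) (trans (cong +_ eq) (ℤₚ.pos-* c d)))

    invertible-pos : ∀ m → ¬ (p ℕ.∣ m) → ∃ λ v → + m * v ≡ 1ℤ ⟨mod + p ⟩
    invertible-pos m p∤m with coprime-Bézout (coprime p∤m)
    ... | Bézout.+- x y eq = - + y , (begin
      + m * - + y              ≡⟨ rearrange (+ m) (+ y) ⟩
      1ℤ - (1ℤ + + y * + m)    ≡⟨ cong (λ s → 1ℤ - s) (pos-Bézout y m x p eq) ⟩
      1ℤ - + x * + p           ≡⟨ cong (λ s → 1ℤ + s) (ℤₚ.neg-distribˡ-* (+ x) (+ p)) ⟩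
      1ℤ + - + x * + p         ≈⟨ x+y*k≡x 1ℤ (- + x) ⟩
      1ℤ                       ∎)
      where
      open ≡-mod-Reasoning (+ p)
      rearrange : ∀ m y → m * - y ≡ 1ℤ - (1ℤ + y * m)
      rearrange = solve-∀
    ... | Bézout.-+ x y eq = + y , (begin
      + m * + y                ≡⟨ ℤₚ.*-comm (+ m) (+ y) ⟩
      + y * + m                ≡⟨ pos-Bézout x p y m eq ⟨
      1ℤ + + x * + p           ≈⟨ x+y*k≡x 1ℤ (+ x) ⟩
      1ℤ                       ∎)
      where open ≡-mod-Reasoning (+ p)

  invertible-mod-prime : ∀ u → ¬ (+ p ∣ u) → ∃ λ v → u * v ≡ 1ℤ ⟨mod + p ⟩
  invertible-mod-prime (+ m) p∤u = invertible-pos m (λ p∣m → p∤u (∣ᵤ⇒∣ p∣m))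
  invertible-mod-prime -[1+ m ] p∤u with invertible-pos (suc m) (λ p∣m → p∤u (∣m⇒∣-m (∣ᵤ⇒∣ p∣m)))
  ... | v , uv≡1 = - v , subst (λ z → z ≡ 1ℤ ⟨mod + p ⟩) (negate-both (+ suc m) v) uv≡1
    where
    negate-both : ∀ u v → u * v ≡ (- u) * (- v)
    negate-both = solve-∀

invertible-mod-^ : ∀ {k} u v → u * v ≡ 1ℤ ⟨mod k ⟩ → ∀ i → ∃ λ w → u * w ≡ 1ℤ ⟨mod k ^ i ⟩
invertible-mod-^ u v _ zero = 0ℤ , congruence (divides (u * 0ℤ - 1ℤ) (sym (ℤₚ.*-identityʳ _)))
invertible-mod-^ {k} u v uv≡1@(congruence (divides e uv-1≡ek)) (suc i)
  with invertible-mod-^ u v uv≡1 i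
... | w , congruence (divides c uw-1≡ckⁱ) =
  w - c * v * k ^ i ,
  ≡-mod-by (trans (expand u v w c (k ^ i))
                  (trans (cong₂ (λ s t → s - c * k ^ i - c * t * k ^ i) uw-1≡ckⁱ uv-1≡ek)
                         (collect c e k (k ^ i))))
           (∣n⇒∣m*n (- (c * e)) ∣-refl)
  where
  -- Newton's step: the error c kⁱ of w gets multiplied by u v - 1 ≡ 0.
  expand : ∀ u v w c K → u * (w - c * v * K) - 1ℤ ≡ (u * w - 1ℤ) - c * K - c * (u * v - 1ℤ) * K
  expand = solve-∀
  collect : ∀ c e k K → c * K - c * K - c * (e * k) * K ≡ - (c * e) * (k * K)
  collect = solve-∀

-- Binomial coefficients

[k+1]*[n+1]C[k+1]≡[n+1]*nCk : ∀ n k → suc k ℕ.* (suc n C suc k) ≡ suc n ℕ.* (n C k)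
[k+1]*[n+1]C[k+1]≡[n+1]*nCk n zero =
  trans (ℕₚ.*-identityˡ _) (trans (nC1≡n (suc n)) (sym (ℕₚ.*-identityʳ (suc n))))
[k+1]*[n+1]C[k+1]≡[n+1]*nCk zero (suc k)
  rewrite k>n⇒nCk≡0 {1} {suc (suc k)} (s≤s (s≤s z≤n)) | k>n⇒nCk≡0 {0} {suc k} (s≤s z≤n) =
  ℕₚ.*-zeroʳ (suc (suc k))
[k+1]*[n+1]C[k+1]≡[n+1]*nCk (suc n) (suc k) = begin
  suc (suc k) ℕ.* (suc (suc n) C suc (suc k))
    ≡⟨ cong (suc (suc k) ℕ.*_) (nCk+nC[k+1]≡[n+1]C[k+1] (suc n) (suc k)) ⟨
  suc (suc k) ℕ.* (suc n C suc k ℕ.+ suc n C suc (suc k))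
    ≡⟨ split (suc k) (suc n C suc k) (suc n C suc (suc k)) ⟩
  suc n C suc k ℕ.+ suc k ℕ.* (suc n C suc k) ℕ.+ suc (suc k) ℕ.* (suc n C suc (suc k))
    ≡⟨ cong₂ (λ s t → suc n C suc k ℕ.+ s ℕ.+ t)
             ([k+1]*[n+1]C[k+1]≡[n+1]*nCk n k) ([k+1]*[n+1]C[k+1]≡[n+1]*nCk n (suc k)) ⟩
  suc n C suc k ℕ.+ suc n ℕ.* (n C k) ℕ.+ suc n ℕ.* (n C suc k)
    ≡⟨ merge (suc n C suc k) (suc n) (n C k) (n C suc k) ⟩
  suc n C suc k ℕ.+ suc n ℕ.* (n C k ℕ.+ n C suc k)
    ≡⟨ cong (λ s → suc n C suc k ℕ.+ suc n ℕ.* s) (nCk+nC[k+1]≡[n+1]C[k+1] n k) ⟩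
  suc n C suc k ℕ.+ suc n ℕ.* (suc n C suc k)
    ≡⟨⟩
  suc (suc n) ℕ.* (suc n C suc k) ∎
  where
  open ≡-Reasoning
  split : ∀ k a b → (1 ℕ.+ k) ℕ.* (a ℕ.+ b) ≡ a ℕ.+ k ℕ.* a ℕ.+ (1 ℕ.+ k) ℕ.* b
  split = ℕ-solve-∀
  merge : ∀ c m a b → c ℕ.+ m ℕ.* a ℕ.+ m ℕ.* b ≡ c ℕ.+ m ℕ.* (a ℕ.+ b)
  merge = ℕ-solve-∀

prime∣pCk : ∀ {p k} → Prime p → 0 ℕ.< k → k ℕ.< p → p ℕ.∣ p C k
prime∣pCk {suc n} {suc k} p-prime _ k<p
  with euclidsLemma (suc k) (suc n C suc k) p-prime
         (ℕ.divides (n C k) (trans ([k+1]*[n+1]C[k+1]≡[n+1]*nCk n k) (ℕₚ.*-comm (suc n) (n C k))))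
... | inj₁ p∣k+1 = ⊥-elim (ℕₚ.<⇒≱ k<p (ℕ.∣⇒≤ p∣k+1))
... | inj₂ p∣pCk = p∣pCk

[1+y]^j≡1+jy : ∀ y j → (1ℤ + y) ^ j ≡ 1ℤ + + j * y ⟨mod y * y ⟩
[1+y]^j≡1+jy y zero = ≡⇒≡-mod (sym (unit y))
  where
  unit : ∀ y → 1ℤ + 0ℤ * y ≡ 1ℤ
  unit = solve-∀
[1+y]^j≡1+jy y (suc j) = begin
  (1ℤ + y) * (1ℤ + y) ^ j      ≈⟨ *-congˡ (1ℤ + y) ([1+y]^j≡1+jy y j) ⟩
  (1ℤ + y) * (1ℤ + + j * y)    ≈⟨ ≡-mod-by (expand y (+ j)) (∣n⇒∣m*n (+ j) ∣-refl) ⟩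
  1ℤ + (1ℤ + + j) * y          ≡⟨ cong (λ s → 1ℤ + s * y) (ℤₚ.pos-+ 1 j) ⟨
  1ℤ + + suc j * y             ∎
  where
  open ≡-mod-Reasoning (y * y)
  expand : ∀ y j → (1ℤ + y) * (1ℤ + j * y) - (1ℤ + (1ℤ + j) * y) ≡ j * (y * y)
  expand = solve-∀

[1+y]^j≡1+jy+jC2y² : ∀ y j → (1ℤ + y) ^ j ≡ 1ℤ + + j * y + + (j C 2) * (y * y) ⟨mod y * (y * y) ⟩
[1+y]^j≡1+jy+jC2y² y zero = ≡⇒≡-mod (sym (unit y))
  where
  unit : ∀ y → 1ℤ + 0ℤ * y + 0ℤ * (y * y) ≡ 1ℤ
  unit = solve-∀
[1+y]^j≡1+jy+jC2y² y (suc j) = begin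
  (1ℤ + y) * (1ℤ + y) ^ j
    ≈⟨ *-congˡ (1ℤ + y) ([1+y]^j≡1+jy+jC2y² y j) ⟩
  (1ℤ + y) * (1ℤ + + j * y + + (j C 2) * (y * y))
    ≈⟨ ≡-mod-by (expand y (+ j) (+ (j C 2))) (∣n⇒∣m*n (+ (j C 2)) ∣-refl) ⟩
  1ℤ + (1ℤ + + j) * y + (+ j + + (j C 2)) * (y * y)
    ≡⟨ cong₂ (λ s t → 1ℤ + s * y + t * (y * y)) (ℤₚ.pos-+ 1 j) (ℤₚ.pos-+ j (j C 2)) ⟨
  1ℤ + + suc j * y + + (j ℕ.+ j C 2) * (y * y)
    ≡⟨ cong (λ s → 1ℤ + + suc j * y + + (s ℕ.+ j C 2) * (y * y)) (nC1≡n j) ⟨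
  1ℤ + + suc j * y + + (j C 1 ℕ.+ j C 2) * (y * y)
    ≡⟨ cong (λ s → 1ℤ + + suc j * y + + s * (y * y)) (nCk+nC[k+1]≡[n+1]C[k+1] j 1) ⟩
  1ℤ + + suc j * y + + (suc j C 2) * (y * y) ∎
  where
  open ≡-mod-Reasoning (y * (y * y))
  expand : ∀ y j c → (1ℤ + y) * (1ℤ + j * y + c * (y * y)) - (1ℤ + (1ℤ + j) * y + (j + c) * (y * y))
                   ≡ c * (y * (y * y))
  expand = solve-∀

-- Powers of integers congruent to 1 modulo a multiple of p

1+[x-1]≡x : ∀ x → 1ℤ + (x - 1ℤ) ≡ x
1+[x-1]≡x = solve-∀

module _ {p : ℕ} (p-prime : Prime p) where

  private instance
    p≢0 : NonZero p
    p≢0 = prime⇒nonZero p-prime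

  ≢1⇒^p≢1 : ∀ {q y} → 2 ℕ.< p → + p ∣ q → y ≡ 1ℤ ⟨mod q ⟩ → ¬ y ≡ 1ℤ ⟨mod + p * q ⟩ →
            ¬ y ^ p ≡ 1ℤ ⟨mod + p * (+ p * q) ⟩
  ≢1⇒^p≢1 {q} {y} 2<p p∣q (congruence q∣z) y≢1 y^p≡1 = y≢1 (congruence (*-cancelˡ-∣ (+ p) M∣pz))
    where
    z M : ℤ
    z = y - 1ℤ
    M = + p * (+ p * q)
    p∣z : + p ∣ z
    p∣z = ∣-trans p∣q q∣z
    -- This is where p ≠ 2 is needed.
    M∣Cz² : M ∣ + (p C 2) * (z * z)
    M∣Cz² = *-pres-∣ (∣ᵤ⇒∣ {+ p} {+ (p C 2)} (prime∣pCk p-prime (s≤s z≤n) 2<p)) (*-pres-∣ p∣z q∣z)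
    y^p≡1+pz : y ^ p ≡ 1ℤ + + p * z ⟨mod M ⟩
    y^p≡1+pz = begin
      y ^ p                                   ≡⟨ cong (_^ p) (1+[x-1]≡x y) ⟨
      (1ℤ + z) ^ p                            ≈⟨ ≡-mod-∣ (*-pres-∣ p∣z (*-pres-∣ p∣z q∣z)) ([1+y]^j≡1+jy+jC2y² z p) ⟩
      1ℤ + + p * z + + (p C 2) * (z * z)      ≈⟨ +-cong (≡-mod-refl {x = 1ℤ + + p * z}) (∣⇒≡-mod-0 M∣Cz²) ⟩
      1ℤ + + p * z + 0ℤ                       ≡⟨ ℤₚ.+-identityʳ _ ⟩
      1ℤ + + p * z                            ∎
      where open ≡-mod-Reasoning M
    M∣pz : M ∣ + p * z
    M∣pz = subst (M ∣_) (cancel (+ p * z)) (∣-difference (≡-mod-trans (≡-mod-sym y^p≡1+pz) y^p≡1))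
      where
      cancel : ∀ w → 1ℤ + w - 1ℤ ≡ w
      cancel = solve-∀

  ^-hits-1+q : ∀ {q y x} → + p ∣ q → y ≡ 1ℤ ⟨mod q ⟩ → ¬ y ≡ 1ℤ ⟨mod + p * q ⟩ → x ≡ 1ℤ ⟨mod q ⟩ →
               ∃ λ j → y ^ j ≡ x ⟨mod + p * q ⟩
  ^-hits-1+q {q} {y} {x} p∣q (congruence (divides u y-1≡uq)) y≢1 (congruence (divides s x-1≡sq)) = j , yʲ≡x
    where
    q∣y-1 : q ∣ y - 1ℤ
    q∣y-1 = divides u y-1≡uq
    p∤u : ¬ (+ p ∣ u)
    p∤u p∣u = y≢1 (congruence (subst (+ p * q ∣_) (sym y-1≡uq) (*-monoˡ-∣ q p∣u)))
    -- j ≡ s / u modulo p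
    v : ℤ
    v = proj₁ (invertible-mod-prime p-prime u p∤u)
    j : ℕ
    j = (s * v) % + p
    ju≡s : + j * u ≡ s ⟨mod + p ⟩
    ju≡s = begin
      + j * u       ≈⟨ *-congʳ u ([x%k]≡x (s * v) (+ p)) ⟩
      s * v * u     ≡⟨ reorder s v u ⟩
      s * (u * v)   ≈⟨ *-congˡ s (proj₂ (invertible-mod-prime p-prime u p∤u)) ⟩
      s * 1ℤ        ≡⟨ ℤₚ.*-identityʳ s ⟩
      s             ∎
      where
      open ≡-mod-Reasoning (+ p)
      reorder : ∀ s v u → s * v * u ≡ s * (u * v)
      reorder = solve-∀
    yʲ≡x : y ^ j ≡ x ⟨mod + p * q ⟩
    yʲ≡x = begin
      y ^ j                  ≡⟨ cong (_^ j) (1+[x-1]≡x y) ⟨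
      (1ℤ + (y - 1ℤ)) ^ j    ≈⟨ ≡-mod-∣ (*-pres-∣ (∣-trans p∣q q∣y-1) q∣y-1) ([1+y]^j≡1+jy (y - 1ℤ) j) ⟩
      1ℤ + + j * (y - 1ℤ)    ≡⟨ cong (λ t → 1ℤ + + j * t) y-1≡uq ⟩
      1ℤ + + j * (u * q)     ≈⟨ ≡-mod-by (factor (+ j) u s q) (*-monoˡ-∣ q (∣-difference ju≡s)) ⟩
      1ℤ + s * q             ≡⟨ cong (λ t → 1ℤ + t) x-1≡sq ⟨
      1ℤ + (x - 1ℤ)          ≡⟨ 1+[x-1]≡x x ⟩
      x                      ∎
      where
      open ≡-mod-Reasoning (+ p * q)
      factor : ∀ j u s q → (1ℤ + j * (u * q)) - (1ℤ + s * q) ≡ (j * u - s) * q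
      factor = solve-∀

-- 2 × 2 matrices

mat-cong : ∀ {a b c d a′ b′ c′ d′} → a ≡ a′ → b ≡ b′ → c ≡ c′ → d ≡ d′ → mat a b c d ≡ mat a′ b′ c′ d′
mat-cong refl refl refl refl = refl

⊗-assoc : ∀ g h k → (g ⊗ h) ⊗ k ≡ g ⊗ (h ⊗ k)
⊗-assoc (mat a b c d) (mat e f g h) (mat i j k l) =
  mat-cong (entry a b e f g h i k) (entry a b e f g h j l) (entry c d e f g h i k) (entry c d e f g h j l)
  where
  entry : ∀ a b e f g h i k →
          (a * e + b * g) * i + (a * f + b * h) * k ≡ a * (e * i + f * k) + b * (g * i + h * k)
  entry = solve-∀

⊗-identityˡ : ∀ g → I₂ ⊗ g ≡ g
⊗-identityˡ (mat a b c d) = mat-cong (first a c) (first b d) (second a c) (second b d)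
  where
  first : ∀ x y → 1ℤ * x + 0ℤ * y ≡ x
  first = solve-∀
  second : ∀ x y → 0ℤ * x + 1ℤ * y ≡ y
  second = solve-∀

⊗-identityʳ : ∀ g → g ⊗ I₂ ≡ g
⊗-identityʳ (mat a b c d) = mat-cong (first a b) (second a b) (first c d) (second c d)
  where
  first : ∀ x y → x * 1ℤ + y * 0ℤ ≡ x
  first = solve-∀
  second : ∀ x y → x * 0ℤ + y * 1ℤ ≡ y
  second = solve-∀

det-⊗ : ∀ g h → det (g ⊗ h) ≡ det g * det h
det-⊗ (mat a b c d) (mat e f g h) = binet a b c d e f g h
  where
  binet : ∀ a b c d e f g h → (a * e + b * g) * (c * f + d * h) - (a * f + b * h) * (c * e + d * g)
                              ≡ (a * d - b * c) * (e * h - f * g)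
  binet = solve-∀

infixr 8 _^ᴹ_
_^ᴹ_ : M2 → ℕ → M2
g ^ᴹ zero  = I₂
g ^ᴹ suc k = g ⊗ (g ^ᴹ k)

det-^ᴹ : ∀ g n → det (g ^ᴹ n) ≡ det g ^ n
det-^ᴹ g zero    = refl
det-^ᴹ g (suc n) = trans (det-⊗ g (g ^ᴹ n)) (cong (det g *_) (det-^ᴹ g n))

^ᴹ-distribˡ-+-⊗ : ∀ g i j → g ^ᴹ (i ℕ.+ j) ≡ (g ^ᴹ i) ⊗ (g ^ᴹ j)
^ᴹ-distribˡ-+-⊗ g zero    j = sym (⊗-identityˡ (g ^ᴹ j))
^ᴹ-distribˡ-+-⊗ g (suc i) j =
  trans (cong (g ⊗_) (^ᴹ-distribˡ-+-⊗ g i j)) (sym (⊗-assoc g (g ^ᴹ i) (g ^ᴹ j)))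

^ᴹ-*-assoc : ∀ g i j → (g ^ᴹ i) ^ᴹ j ≡ g ^ᴹ (i ℕ.* j)
^ᴹ-*-assoc g i zero    = cong (g ^ᴹ_) (sym (ℕₚ.*-zeroʳ i))
^ᴹ-*-assoc g i (suc j) = begin
  (g ^ᴹ i) ⊗ ((g ^ᴹ i) ^ᴹ j) ≡⟨ cong ((g ^ᴹ i) ⊗_) (^ᴹ-*-assoc g i j) ⟩
  (g ^ᴹ i) ⊗ (g ^ᴹ (i ℕ.* j)) ≡⟨ ^ᴹ-distribˡ-+-⊗ g i (i ℕ.* j) ⟨
  g ^ᴹ (i ℕ.+ i ℕ.* j)     ≡⟨ cong (g ^ᴹ_) (ℕₚ.*-suc i j) ⟨
  g ^ᴹ (i ℕ.* suc j)       ∎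
  where open ≡-Reasoning

I₂^ᴹn≡I₂ : ∀ n → I₂ ^ᴹ n ≡ I₂
I₂^ᴹn≡I₂ zero    = refl
I₂^ᴹn≡I₂ (suc n) = trans (⊗-identityˡ (I₂ ^ᴹ n)) (I₂^ᴹn≡I₂ n)

infix 4 _≋_⟨mod_⟩
record _≋_⟨mod_⟩ (g h : M2) (k : ℤ) : Set where
  constructor entrywise
  field
    a-≡ : a g ≡ a h ⟨mod k ⟩
    b-≡ : b g ≡ b h ⟨mod k ⟩
    c-≡ : c g ≡ c h ⟨mod k ⟩
    d-≡ : d g ≡ d h ⟨mod k ⟩
open _≋_⟨mod_⟩ public

module _ {k : ℤ} where

  ≋-mod-refl : ∀ {g} → g ≋ g ⟨mod k ⟩
  ≋-mod-refl = entrywise ≡-mod-refl ≡-mod-refl ≡-mod-refl ≡-mod-refl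

  ≡⇒≋-mod : ∀ {g h} → g ≡ h → g ≋ h ⟨mod k ⟩
  ≡⇒≋-mod refl = ≋-mod-refl

  ≋-mod-sym : ∀ {g h} → g ≋ h ⟨mod k ⟩ → h ≋ g ⟨mod k ⟩
  ≋-mod-sym (entrywise ≡a ≡b ≡c ≡d) = entrywise (≡-mod-sym ≡a) (≡-mod-sym ≡b) (≡-mod-sym ≡c) (≡-mod-sym ≡d)

  ≋-mod-trans : ∀ {g h l} → g ≋ h ⟨mod k ⟩ → h ≋ l ⟨mod k ⟩ → g ≋ l ⟨mod k ⟩
  ≋-mod-trans (entrywise ≡a ≡b ≡c ≡d) (entrywise ≡a′ ≡b′ ≡c′ ≡d′) =
    entrywise (≡-mod-trans ≡a ≡a′) (≡-mod-trans ≡b ≡b′) (≡-mod-trans ≡c ≡c′) (≡-mod-trans ≡d ≡d′)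

  ≋-mod-isEquivalence : IsEquivalence _≋_⟨mod k ⟩
  ≋-mod-isEquivalence = record { refl = ≋-mod-refl ; sym = ≋-mod-sym ; trans = ≋-mod-trans }

  ⊗-cong : ∀ {g g′ h h′} → g ≋ g′ ⟨mod k ⟩ → h ≋ h′ ⟨mod k ⟩ → g ⊗ h ≋ g′ ⊗ h′ ⟨mod k ⟩
  ⊗-cong {mat _ _ _ _} {mat _ _ _ _} {mat _ _ _ _} {mat _ _ _ _}
         (entrywise ≡a ≡b ≡c ≡d) (entrywise ≡a′ ≡b′ ≡c′ ≡d′) =
    entrywise (+-cong (*-cong ≡a ≡a′) (*-cong ≡b ≡c′)) (+-cong (*-cong ≡a ≡b′) (*-cong ≡b ≡d′))
              (+-cong (*-cong ≡c ≡a′) (*-cong ≡d ≡c′)) (+-cong (*-cong ≡c ≡b′) (*-cong ≡d ≡d′))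

  ^ᴹ-cong : ∀ {g h} n → g ≋ h ⟨mod k ⟩ → g ^ᴹ n ≋ h ^ᴹ n ⟨mod k ⟩
  ^ᴹ-cong zero    _   = ≋-mod-refl
  ^ᴹ-cong (suc n) g≋h = ⊗-cong g≋h (^ᴹ-cong n g≋h)

  ≋I₂⇒^ᴹ≋I₂ : ∀ {g} n → g ≋ I₂ ⟨mod k ⟩ → g ^ᴹ n ≋ I₂ ⟨mod k ⟩
  ≋I₂⇒^ᴹ≋I₂ n g≋I₂ = ≋-mod-trans (^ᴹ-cong n g≋I₂) (≡⇒≋-mod (I₂^ᴹn≡I₂ n))

  det-cong : ∀ {g h} → g ≋ h ⟨mod k ⟩ → det g ≡ det h ⟨mod k ⟩
  det-cong {mat _ _ _ _} {mat _ _ _ _} (entrywise ≡a ≡b ≡c ≡d) =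
    +-cong (*-cong ≡a ≡d) (-‿cong (*-cong ≡b ≡c))

≋-mod-setoid : ℤ → Setoid 0ℓ 0ℓ
≋-mod-setoid k = record { isEquivalence = ≋-mod-isEquivalence {k} }

module ≋-mod-Reasoning (k : ℤ) = ≈-Reasoning (≋-mod-setoid k)

≋-mod-∣ : ∀ {k k′ g h} → k ∣ k′ → g ≋ h ⟨mod k′ ⟩ → g ≋ h ⟨mod k ⟩
≋-mod-∣ k∣k′ (entrywise ≡a ≡b ≡c ≡d) =
  entrywise (≡-mod-∣ k∣k′ ≡a) (≡-mod-∣ k∣k′ ≡b) (≡-mod-∣ k∣k′ ≡c) (≡-mod-∣ k∣k′ ≡d)

⟨mod⟩⇒≋[mod] : ∀ {m g h} → g ≋ h ⟨mod + m ⟩ → g ≋ h [mod m ]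
⟨mod⟩⇒≋[mod] (entrywise ≡a ≡b ≡c ≡d) = ⟨mod⟩⇒[mod] ≡a , ⟨mod⟩⇒[mod] ≡b , ⟨mod⟩⇒[mod] ≡c , ⟨mod⟩⇒[mod] ≡d

infix 7 I₂+_·[_−I₂]
I₂+_·[_−I₂] : ℤ → M2 → M2
I₂+ j ·[ mat a b c d −I₂] = mat (1ℤ + j * (a - 1ℤ)) (j * b) (j * c) (1ℤ + j * (d - 1ℤ))

-- The binomial expansion of (I₂ + (g − I₂))ʲ, truncated after the linear term.
^ᴹ≋I₂+j·[g−I₂] : ∀ {q} g j → g ≋ I₂ ⟨mod q ⟩ → g ^ᴹ j ≋ I₂+ + j ·[ g −I₂] ⟨mod q * q ⟩
^ᴹ≋I₂+j·[g−I₂] {q} (mat a b c d) j (entrywise (congruence q∣a-1) ≡b ≡c (congruence q∣d-1)) = go j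
  where
  g : M2
  g = mat a b c d
  q∣b : q ∣ b
  q∣b = ≡-mod-0⇒∣ ≡b
  q∣c : q ∣ c
  q∣c = ≡-mod-0⇒∣ ≡c
  go : ∀ j → g ^ᴹ j ≋ I₂+ + j ·[ g −I₂] ⟨mod q * q ⟩
  go zero = ≡⇒≋-mod (sym (mat-cong (diagonal a) (off-diagonal b) (off-diagonal c) (diagonal d)))
    where
    diagonal : ∀ x → 1ℤ + 0ℤ * (x - 1ℤ) ≡ 1ℤ
    diagonal = solve-∀
    off-diagonal : ∀ x → 0ℤ * x ≡ 0ℤ
    off-diagonal = solve-∀
  go (suc j) rewrite ℤₚ.pos-+ 1 j = ≋-mod-trans (⊗-cong (≋-mod-refl {g = g}) (go j)) (entrywise
    (≡-mod-by (expand-a a b c d J) (∣n⇒∣m*n J (∣m∣n⇒∣m+n (*-pres-∣ q∣a-1 q∣a-1) (*-pres-∣ q∣b q∣c))))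
    (≡-mod-by (expand-b a b c d J) (∣n⇒∣m*n J (∣m∣n⇒∣m+n (*-pres-∣ q∣a-1 q∣b) (*-pres-∣ q∣b q∣d-1))))
    (≡-mod-by (expand-c a b c d J) (∣n⇒∣m*n J (∣m∣n⇒∣m+n (*-pres-∣ q∣c q∣a-1) (*-pres-∣ q∣d-1 q∣c))))
    (≡-mod-by (expand-d a b c d J) (∣n⇒∣m*n J (∣m∣n⇒∣m+n (*-pres-∣ q∣c q∣b) (*-pres-∣ q∣d-1 q∣d-1)))))
    where
    J : ℤ
    J = + j
    expand-a : ∀ a b c d J → (a * (1ℤ + J * (a - 1ℤ)) + b * (J * c)) - (1ℤ + (1ℤ + J) * (a - 1ℤ))
                             ≡ J * ((a - 1ℤ) * (a - 1ℤ) + b * c)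
    expand-a = solve-∀
    expand-b : ∀ a b c d J → (a * (J * b) + b * (1ℤ + J * (d - 1ℤ))) - (1ℤ + J) * b
                             ≡ J * ((a - 1ℤ) * b + b * (d - 1ℤ))
    expand-b = solve-∀
    expand-c : ∀ a b c d J → (c * (1ℤ + J * (a - 1ℤ)) + d * (J * c)) - (1ℤ + J) * c
                             ≡ J * (c * (a - 1ℤ) + (d - 1ℤ) * c)
    expand-c = solve-∀
    expand-d : ∀ a b c d J → (c * (J * b) + d * (1ℤ + J * (d - 1ℤ))) - (1ℤ + (1ℤ + J) * (d - 1ℤ))
                             ≡ J * (c * b + (d - 1ℤ) * (d - 1ℤ))
    expand-d = solve-∀

^ᴹ-≋I₂ : ∀ {q} j g → + j ∣ q → g ≋ I₂ ⟨mod q ⟩ → g ^ᴹ j ≋ I₂ ⟨mod + j * q ⟩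
^ᴹ-≋I₂ {q} j g@(mat a b c d) j∣q g≋I₂@(entrywise ≡a ≡b ≡c ≡d) = begin
  g ^ᴹ j                 ≈⟨ ≋-mod-∣ (*-pres-∣ j∣q ∣-refl) (^ᴹ≋I₂+j·[g−I₂] g j g≋I₂) ⟩
  I₂+ + j ·[ g −I₂]      ≈⟨ entrywise (≡-mod-by (diagonal a) (*-monoʳ-∣ (+ j) (∣-difference ≡a)))
                                      (≡-mod-by (off-diagonal b) (*-monoʳ-∣ (+ j) (∣-difference ≡b)))
                                      (≡-mod-by (off-diagonal c) (*-monoʳ-∣ (+ j) (∣-difference ≡c)))
                                      (≡-mod-by (diagonal d) (*-monoʳ-∣ (+ j) (∣-difference ≡d))) ⟩
  I₂                     ∎
  where
  open ≋-mod-Reasoning (+ j * q)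
  diagonal : ∀ x → (1ℤ + + j * (x - 1ℤ)) - 1ℤ ≡ + j * (x - 1ℤ)
  diagonal x = lemma (+ j) x
    where
    lemma : ∀ j x → (1ℤ + j * (x - 1ℤ)) - 1ℤ ≡ j * (x - 1ℤ)
    lemma = solve-∀
  off-diagonal : ∀ x → + j * x - 0ℤ ≡ + j * (x - 0ℤ)
  off-diagonal x = lemma (+ j) x
    where
    lemma : ∀ j x → j * x - 0ℤ ≡ j * (x - 0ℤ)
    lemma = solve-∀

module _ {m : ℕ} {H : M2 → Set} (subgroup : IsSubgroupGL2 m H) where
  open IsSubgroupGL2 subgroup

  ^ᴹ-closed : ∀ {g} n → H g → H (g ^ᴹ n)
  ^ᴹ-closed zero    _  = hasOne
  ^ᴹ-closed (suc n) Hg = mulClosed Hg (^ᴹ-closed n Hg)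

-- The quadratic ring ℤ[θ]

infix 6 _θ+_
record ℤ[θ] : Set where
  constructor _θ+_
  field
    θ-coeff constant : ℤ
open ℤ[θ] public

θ+-cong : ∀ {a b a′ b′} → a ≡ a′ → b ≡ b′ → a θ+ b ≡ a′ θ+ b′
θ+-cong refl refl = refl

infix 4 _≅_⟨mod_⟩
record _≅_⟨mod_⟩ (x y : ℤ[θ]) (k : ℤ) : Set where
  constructor componentwise
  field
    θ-coeff-≡  : θ-coeff x ≡ θ-coeff y ⟨mod k ⟩
    constant-≡ : constant x ≡ constant y ⟨mod k ⟩
open _≅_⟨mod_⟩ public

module _ {k : ℤ} where

  ≅-mod-refl : ∀ {x} → x ≅ x ⟨mod k ⟩
  ≅-mod-refl = componentwise ≡-mod-refl ≡-mod-refl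

  ≡⇒≅-mod : ∀ {x y} → x ≡ y → x ≅ y ⟨mod k ⟩
  ≡⇒≅-mod refl = ≅-mod-refl

  ≅-mod-sym : ∀ {x y} → x ≅ y ⟨mod k ⟩ → y ≅ x ⟨mod k ⟩
  ≅-mod-sym (componentwise ≡a ≡b) = componentwise (≡-mod-sym ≡a) (≡-mod-sym ≡b)

  ≅-mod-trans : ∀ {x y z} → x ≅ y ⟨mod k ⟩ → y ≅ z ⟨mod k ⟩ → x ≅ z ⟨mod k ⟩
  ≅-mod-trans (componentwise ≡a ≡b) (componentwise ≡a′ ≡b′) =
    componentwise (≡-mod-trans ≡a ≡a′) (≡-mod-trans ≡b ≡b′)

  ≅-mod-isEquivalence : IsEquivalence _≅_⟨mod k ⟩
  ≅-mod-isEquivalence = record { refl = ≅-mod-refl ; sym = ≅-mod-sym ; trans = ≅-mod-trans }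

≅-mod-setoid : ℤ → Setoid 0ℓ 0ℓ
≅-mod-setoid k = record { isEquivalence = ≅-mod-isEquivalence {k} }

module ≅-mod-Reasoning (k : ℤ) = ≈-Reasoning (≅-mod-setoid k)

-- Multiplication is that of ℤ[X]/(X² − t X + d), θ being the class of X.
module QuadraticRing (t d : ℤ) where

  infixl 6 _⊕_
  infixl 7 _⊛_

  _⊕_ : ℤ[θ] → ℤ[θ] → ℤ[θ]
  (a θ+ b) ⊕ (c θ+ e) = (a + c) θ+ (b + e)

  _⊛_ : ℤ[θ] → ℤ[θ] → ℤ[θ]
  (a θ+ b) ⊛ (c θ+ e) = (a * e + b * c + a * c * t) θ+ (b * e - a * c * d)

  𝟘 𝟙 θ : ℤ[θ]
  𝟘 = 0ℤ θ+ 0ℤ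
  𝟙 = 0ℤ θ+ 1ℤ
  θ = 1ℤ θ+ 0ℤ

  ⊕-assoc : ∀ x y z → (x ⊕ y) ⊕ z ≡ x ⊕ (y ⊕ z)
  ⊕-assoc (a θ+ b) (c θ+ e) (f θ+ g) = θ+-cong (ℤₚ.+-assoc a c f) (ℤₚ.+-assoc b e g)

  ⊕-comm : ∀ x y → x ⊕ y ≡ y ⊕ x
  ⊕-comm (a θ+ b) (c θ+ e) = θ+-cong (ℤₚ.+-comm a c) (ℤₚ.+-comm b e)

  ⊕-identityˡ : ∀ x → 𝟘 ⊕ x ≡ x
  ⊕-identityˡ (a θ+ b) = θ+-cong (ℤₚ.+-identityˡ a) (ℤₚ.+-identityˡ b)

  ⊕-identityʳ : ∀ x → x ⊕ 𝟘 ≡ x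
  ⊕-identityʳ (a θ+ b) = θ+-cong (ℤₚ.+-identityʳ a) (ℤₚ.+-identityʳ b)

  ⊛-assoc : ∀ x y z → (x ⊛ y) ⊛ z ≡ x ⊛ (y ⊛ z)
  ⊛-assoc (a θ+ b) (c θ+ e) (f θ+ g) = θ+-cong (θ-part a b c e f g t d) (constant-part a b c e f g t d)
    where
    θ-part : ∀ a b c e f g t d →
      (a * e + b * c + a * c * t) * g + (b * e - a * c * d) * f + (a * e + b * c + a * c * t) * f * t
      ≡ a * (e * g - c * f * d) + b * (c * g + e * f + c * f * t) + a * (c * g + e * f + c * f * t) * t
    θ-part = solve-∀
    constant-part : ∀ a b c e f g t d →
      (b * e - a * c * d) * g - (a * e + b * c + a * c * t) * f * d
      ≡ b * (e * g - c * f * d) - a * (c * g + e * f + c * f * t) * d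
    constant-part = solve-∀

  ⊛-comm : ∀ x y → x ⊛ y ≡ y ⊛ x
  ⊛-comm (a θ+ b) (c θ+ e) = θ+-cong (θ-part a b c e t) (constant-part a b c e d)
    where
    θ-part : ∀ a b c e t → a * e + b * c + a * c * t ≡ c * b + e * a + c * a * t
    θ-part = solve-∀
    constant-part : ∀ a b c e d → b * e - a * c * d ≡ e * b - c * a * d
    constant-part = solve-∀

  ⊛-identityˡ : ∀ x → 𝟙 ⊛ x ≡ x
  ⊛-identityˡ (a θ+ b) = θ+-cong (θ-part a b t) (constant-part a b d)
    where
    θ-part : ∀ a b t → 0ℤ * b + 1ℤ * a + 0ℤ * a * t ≡ a
    θ-part = solve-∀
    constant-part : ∀ a b d → 1ℤ * b - 0ℤ * a * d ≡ b
    constant-part = solve-∀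

  ⊛-identityʳ : ∀ x → x ⊛ 𝟙 ≡ x
  ⊛-identityʳ x = trans (⊛-comm x 𝟙) (⊛-identityˡ x)

  ⊛-distribʳ-⊕ : ∀ x y z → (y ⊕ z) ⊛ x ≡ (y ⊛ x) ⊕ (z ⊛ x)
  ⊛-distribʳ-⊕ (a θ+ b) (c θ+ e) (f θ+ g) = θ+-cong (θ-part a b c e f g t) (constant-part a b c e f g d)
    where
    θ-part : ∀ a b c e f g t →
      (c + f) * b + (e + g) * a + (c + f) * a * t ≡ (c * b + e * a + c * a * t) + (f * b + g * a + f * a * t)
    θ-part = solve-∀
    constant-part : ∀ a b c e f g d → (e + g) * b - (c + f) * a * d ≡ (e * b - c * a * d) + (g * b - f * a * d)
    constant-part = solve-∀

  ⊛-zeroˡ : ∀ x → 𝟘 ⊛ x ≡ 𝟘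
  ⊛-zeroˡ (a θ+ b) = θ+-cong (θ-part a b t) (constant-part a b d)
    where
    θ-part : ∀ a b t → 0ℤ * b + 0ℤ * a + 0ℤ * a * t ≡ 0ℤ
    θ-part = solve-∀
    constant-part : ∀ a b d → 0ℤ * b - 0ℤ * a * d ≡ 0ℤ
    constant-part = solve-∀

  commutativeSemiring : CommutativeSemiring 0ℓ 0ℓ
  commutativeSemiring = record
    { isCommutativeSemiring = IsCommutativeSemiringˡ.isCommutativeSemiring (record
      { +-isCommutativeMonoid = record
        { isMonoid = record
          { isSemigroup = record
            { isMagma = record { isEquivalence = isEquivalence ; ∙-cong = cong₂ _⊕_ }
            ; assoc = ⊕-assoc }
          ; identity = ⊕-identityˡ , ⊕-identityʳ }
        ; comm = ⊕-comm }
      ; *-isCommutativeMonoid = record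
        { isMonoid = record
          { isSemigroup = record
            { isMagma = record { isEquivalence = isEquivalence ; ∙-cong = cong₂ _⊛_ }
            ; assoc = ⊛-assoc }
          ; identity = ⊛-identityˡ , ⊛-identityʳ }
        ; comm = ⊛-comm }
      ; distribʳ = ⊛-distribʳ-⊕
      ; zeroˡ = ⊛-zeroˡ
      }) }

  open CommutativeSemiring commutativeSemiring using (semiring; +-rawMonoid)
  open import Algebra.Properties.Semiring.Exp semiring public
    using () renaming (_^_ to infixr 8 _⊛^_; ^-homo-* to ⊛^-distribˡ-+-⊛; ^-assocʳ to ⊛^-*-assoc)
  open import Algebra.Properties.CommutativeSemiring.Exp commutativeSemiring public
    using () renaming (^-distrib-* to ⊛^-distribʳ-⊛)
  open import Algebra.Definitions.RawMonoid +-rawMonoid using (sum) renaming (_×_ to _×ₙ_)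
  import Algebra.Properties.CommutativeSemiring.Binomial commutativeSemiring as Binomial
  open import Algebra.Properties.Monoid.Sum (CommutativeSemiring.+-monoid commutativeSemiring)
    using (sum-init-last)

  module _ {k : ℤ} where

    ⊕-cong : ∀ {x x′ y y′} → x ≅ x′ ⟨mod k ⟩ → y ≅ y′ ⟨mod k ⟩ → x ⊕ y ≅ x′ ⊕ y′ ⟨mod k ⟩
    ⊕-cong {_ θ+ _} {_ θ+ _} {_ θ+ _} {_ θ+ _} (componentwise ≡a ≡b) (componentwise ≡a′ ≡b′) =
      componentwise (+-cong ≡a ≡a′) (+-cong ≡b ≡b′)

    ⊛-cong : ∀ {x x′ y y′} → x ≅ x′ ⟨mod k ⟩ → y ≅ y′ ⟨mod k ⟩ → x ⊛ y ≅ x′ ⊛ y′ ⟨mod k ⟩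
    ⊛-cong {_ θ+ _} {_ θ+ _} {_ θ+ _} {_ θ+ _} (componentwise ≡a ≡b) (componentwise ≡a′ ≡b′) =
      componentwise (+-cong (+-cong (*-cong ≡a ≡b′) (*-cong ≡b ≡a′)) (*-congʳ t (*-cong ≡a ≡a′)))
                    (+-cong (*-cong ≡b ≡b′) (-‿cong (*-congʳ d (*-cong ≡a ≡a′))))

    ⊛^-cong : ∀ {x y} n → x ≅ y ⟨mod k ⟩ → x ⊛^ n ≅ y ⊛^ n ⟨mod k ⟩
    ⊛^-cong zero    _   = ≅-mod-refl
    ⊛^-cong (suc n) x≅y = ⊛-cong x≅y (⊛^-cong n x≅y)

    ⊕-cancelʳ : ∀ {x y} z → x ⊕ z ≅ y ⊕ z ⟨mod k ⟩ → x ≅ y ⟨mod k ⟩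
    ⊕-cancelʳ {_ θ+ _} {_ θ+ _} (c θ+ e) (componentwise ≡a ≡b) =
      componentwise (+-cancelʳ-≡-mod c ≡a) (+-cancelʳ-≡-mod e ≡b)

    ×ₙ≡ : ∀ n x → n ×ₙ x ≡ (+ n * θ-coeff x) θ+ (+ n * constant x)
    ×ₙ≡ zero    (a θ+ b) = θ+-cong (sym (ℤₚ.*-zeroˡ a)) (sym (ℤₚ.*-zeroˡ b))
    ×ₙ≡ (suc n) (a θ+ b) = trans (cong ((a θ+ b) ⊕_) (×ₙ≡ n (a θ+ b)))
                                 (θ+-cong (suc-* (+ n) a) (suc-* (+ n) b))
      where
      suc-* : ∀ n a → a + n * a ≡ (1ℤ + n) * a
      suc-* = solve-∀

    ∣⇒×ₙ≅𝟘 : ∀ {n} x → k ∣ + n → n ×ₙ x ≅ 𝟘 ⟨mod k ⟩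
    ∣⇒×ₙ≅𝟘 {n} x@(a θ+ b) k∣n = subst (λ y → y ≅ 𝟘 ⟨mod k ⟩) (sym (×ₙ≡ n x))
      (componentwise (∣⇒≡-mod-0 (∣m⇒∣m*n a k∣n)) (∣⇒≡-mod-0 (∣m⇒∣m*n b k∣n)))

    sum≅𝟘 : ∀ {n} (f : Vector ℤ[θ] n) → (∀ i → f i ≅ 𝟘 ⟨mod k ⟩) → sum f ≅ 𝟘 ⟨mod k ⟩
    sum≅𝟘 {zero}  f _     = ≅-mod-refl
    sum≅𝟘 {suc n} f f≅𝟘 = ≅-mod-trans (⊕-cong (f≅𝟘 Fin.zero) (sum≅𝟘 (tail f) (f≅𝟘 ∘ Fin.suc)))
                                       (≡⇒≅-mod (⊕-identityˡ 𝟘))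

  𝟙⊛^n≡𝟙 : ∀ n → 𝟙 ⊛^ n ≡ 𝟙
  𝟙⊛^n≡𝟙 zero    = refl
  𝟙⊛^n≡𝟙 (suc n) = trans (cong (𝟙 ⊛_) (𝟙⊛^n≡𝟙 n)) (⊛-identityˡ 𝟙)

  frobenius : ∀ {p} → Prime p → ∀ x → (x ⊕ 𝟙) ⊛^ p ≅ x ⊛^ p ⊕ 𝟙 ⟨mod + p ⟩
  frobenius {suc p₁} p-prime x = begin
    (x ⊕ 𝟙) ⊛^ p                               ≡⟨ Binomial.theorem p x 𝟙 ⟩
    term Fin.zero ⊕ sum (tail term)             ≡⟨ cong (term Fin.zero ⊕_) (sum-init-last (tail term)) ⟩
    term Fin.zero ⊕ (sum (init (tail term)) ⊕ last (tail term))
      ≈⟨ ⊕-cong (≡⇒≅-mod first) (⊕-cong middle (≡⇒≅-mod final)) ⟩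
    𝟙 ⊕ (𝟘 ⊕ x ⊛^ p)                           ≡⟨ cong (𝟙 ⊕_) (⊕-identityˡ (x ⊛^ p)) ⟩
    𝟙 ⊕ x ⊛^ p                                  ≡⟨ ⊕-comm 𝟙 (x ⊛^ p) ⟩
    x ⊛^ p ⊕ 𝟙                                  ∎
    where
    open ≅-mod-Reasoning (+ suc p₁)
    p : ℕ
    p = suc p₁
    term : Vector ℤ[θ] (suc p)
    term = Binomial.binomialTerm x 𝟙 p
    first : term Fin.zero ≡ 𝟙
    first = trans (⊕-identityʳ _) (trans (⊛-identityˡ _) (𝟙⊛^n≡𝟙 p))
    final : last (tail term) ≡ x ⊛^ p
    final rewrite Finₚ.toℕ-fromℕ p₁ | nCn≡1 p | ℕₚ.n∸n≡0 p = trans (⊕-identityʳ _) (⊛-identityʳ _)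
    middle : sum (init (tail term)) ≅ 𝟘 ⟨mod + p ⟩
    middle = sum≅𝟘 (init (tail term)) λ i → ∣⇒×ₙ≅𝟘 _ (∣ᵤ⇒∣ (prime∣pCk p-prime (s≤s z≤n)
               (s≤s (subst (ℕ._< p₁) (sym (Finₚ.toℕ-inject₁ i)) (Finₚ.toℕ<n i)))))


  N : ℤ[θ] → ℤ
  N (a θ+ b) = b * b + a * b * t + a * a * d

  τ : ℤ[θ] → ℤ
  τ (a θ+ b) = a * t + (b + b)

  infix 7 _·_
  _·_ : ℤ → ℤ[θ] → ℤ[θ]
  c · x = (c * θ-coeff x) θ+ (c * constant x)

  N-⊛ : ∀ x y → N (x ⊛ y) ≡ N x * N y
  N-⊛ (a θ+ b) (c θ+ e) = multiplicative a b c e t d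
    where
    multiplicative : ∀ a b c e t d →
      (b * e - a * c * d) * (b * e - a * c * d) + (a * e + b * c + a * c * t) * (b * e - a * c * d) * t
        + (a * e + b * c + a * c * t) * (a * e + b * c + a * c * t) * d
      ≡ (b * b + a * b * t + a * a * d) * (e * e + c * e * t + c * c * d)
    multiplicative = solve-∀

  N-⊛^ : ∀ x n → N (x ⊛^ n) ≡ N x ^ n
  N-⊛^ x zero    = N-𝟙 t d
    where
    N-𝟙 : ∀ t d → 1ℤ * 1ℤ + 0ℤ * 1ℤ * t + 0ℤ * 0ℤ * d ≡ 1ℤ
    N-𝟙 = solve-∀
  N-⊛^ x (suc n) = trans (N-⊛ x (x ⊛^ n)) (cong (N x *_) (N-⊛^ x n))

  ≅𝟘⇒∣N : ∀ {k} x → x ≅ 𝟘 ⟨mod k ⟩ → k ∣ N x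
  ≅𝟘⇒∣N {k} (a θ+ b) (componentwise ≡a ≡b) =
    ∣m∣n⇒∣m+n (∣m∣n⇒∣m+n (∣n⇒∣m*n b k∣b) (∣m⇒∣m*n t (∣m⇒∣m*n b k∣a))) (∣m⇒∣m*n d (∣n⇒∣m*n a k∣a))
    where
    k∣a : k ∣ a
    k∣a = ≡-mod-0⇒∣ ≡a
    k∣b : k ∣ b
    k∣b = ≡-mod-0⇒∣ ≡b

  -- Cayley–Hamilton: x² = τ x · x − N x, so powers of x are multiples of x modulo N x.
  ⊛^≅τ^·x : ∀ {k} x → k ∣ N x → ∀ n → x ⊛^ suc n ≅ τ x ^ n · x ⟨mod k ⟩
  ⊛^≅τ^·x (a θ+ b) k∣N zero = ≡⇒≅-mod (trans (⊛-identityʳ _) (θ+-cong (sym (ℤₚ.*-identityˡ a)) (sym (ℤₚ.*-identityˡ b))))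
  ⊛^≅τ^·x {k} x@(a θ+ b) k∣N (suc n) = begin
    x ⊛ x ⊛^ suc n            ≈⟨ ⊛-cong (≅-mod-refl {x = x}) (⊛^≅τ^·x x k∣N n) ⟩
    x ⊛ (τ x ^ n · x)         ≈⟨ componentwise (≡⇒≡-mod (θ-part a b (τ x ^ n) t))
                                               (≡-mod-by (constant-part a b (τ x ^ n) t d) (∣m⇒∣-m (∣n⇒∣m*n (τ x ^ n) k∣N))) ⟩
    (τ x ^ n * τ x) · x       ≡⟨ cong (_· x) (ℤₚ.*-comm (τ x ^ n) (τ x)) ⟩
    τ x ^ suc n · x           ∎
    where
    open ≅-mod-Reasoning k
    θ-part : ∀ a b c t → a * (c * b) + b * (c * a) + a * (c * a) * t ≡ c * (a * t + (b + b)) * a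
    θ-part = solve-∀
    constant-part : ∀ a b c t d →
      (b * (c * b) - a * (c * a) * d) - c * (a * t + (b + b)) * b ≡ - (c * (b * b + a * b * t + a * a * d))
    constant-part = solve-∀

  τ²-4N≡a²[t²-4d] : ∀ a b → τ (a θ+ b) * τ (a θ+ b) - + 4 * N (a θ+ b) ≡ a * a * (t * t - + 4 * d)
  τ²-4N≡a²[t²-4d] a b = identity a b t d
    where
    identity : ∀ a b t d → (a * t + (b + b)) * (a * t + (b + b)) - + 4 * (b * b + a * b * t + a * a * d)
                           ≡ a * a * (t * t - + 4 * d)
    identity = solve-∀

  module _ {p} (p-prime : Prime p) where

    ∣N⇒∣θ-coeff⇒∣constant : ∀ x → + p ∣ N x → + p ∣ θ-coeff x → + p ∣ constant x
    ∣N⇒∣θ-coeff⇒∣constant (a θ+ b) p∣N p∣a = prime∣x*x⇒∣x p-prime b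
      (subst (+ p ∣_) (N-a[bt+ad]≡b² a b t d) (∣m∣n⇒∣m-n p∣N (∣m⇒∣m*n (b * t + a * d) p∣a)))
      where
      N-a[bt+ad]≡b² : ∀ a b t d → (b * b + a * b * t + a * a * d) - a * (b * t + a * d) ≡ b * b
      N-a[bt+ad]≡b² = solve-∀

    ∣N⇒∣τ⇒∣θ-coeff : ¬ (+ p ∣ t * t - + 4 * d) → ∀ x → + p ∣ N x → + p ∣ τ x → + p ∣ θ-coeff x
    ∣N⇒∣τ⇒∣θ-coeff p∤disc (a θ+ b) p∣N p∣τ =
      [ prime∣x*x⇒∣x p-prime a , (λ p∣disc → ⊥-elim (p∤disc p∣disc)) ]′
        (prime∣*⇒∣⊎∣ p-prime (a * a) (t * t - + 4 * d) p∣a²disc)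
      where
      p∣a²disc : + p ∣ a * a * (t * t - + 4 * d)
      p∣a²disc = subst (+ p ∣_) (τ²-4N≡a²[t²-4d] a b)
                   (∣m∣n⇒∣m-n (∣m⇒∣m*n (τ (a θ+ b)) p∣τ) (∣n⇒∣m*n (+ 4) p∣N))

  ⊛^p≅𝟘⇒≅𝟘 : ∀ {p} → Prime p → ¬ (+ p ∣ t * t - + 4 * d) → ∀ x → x ⊛^ p ≅ 𝟘 ⟨mod + p ⟩ → x ≅ 𝟘 ⟨mod + p ⟩
  ⊛^p≅𝟘⇒≅𝟘 {suc p₁} p-prime p∤disc x xᵖ≅𝟘 =
    componentwise (∣⇒≡-mod-0 p∣a) (∣⇒≡-mod-0 (∣N⇒∣θ-coeff⇒∣constant p-prime x p∣N p∣a))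
    where
    p : ℕ
    p = suc p₁
    p∣N : + p ∣ N x
    p∣N = prime∣^⇒∣ p-prime (N x) p (subst (+ p ∣_) (N-⊛^ x p) (≅𝟘⇒∣N (x ⊛^ p) xᵖ≅𝟘))
    p∣τᵖ⁻¹a : + p ∣ τ x ^ p₁ * θ-coeff x
    p∣τᵖ⁻¹a = ≡-mod-0⇒∣ (≡-mod-trans (≡-mod-sym (θ-coeff-≡ (⊛^≅τ^·x x p∣N p₁))) (θ-coeff-≡ xᵖ≅𝟘))
    p∣a : + p ∣ θ-coeff x
    p∣a = [ (λ p∣τᵖ⁻¹ → ∣N⇒∣τ⇒∣θ-coeff p-prime p∤disc x p∣N (prime∣^⇒∣ p-prime (τ x) p₁ p∣τᵖ⁻¹)) , id ]′
            (prime∣*⇒∣⊎∣ p-prime (τ x ^ p₁) (θ-coeff x) p∣τᵖ⁻¹a)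

  module _ {p} (p-prime : Prime p) (p∤disc : ¬ (+ p ∣ t * t - + 4 * d)) where

    ⊛^p≅𝟙⇒≅𝟙 : ∀ w → w ⊛^ p ≅ 𝟙 ⟨mod + p ⟩ → w ≅ 𝟙 ⟨mod + p ⟩
    ⊛^p≅𝟙⇒≅𝟙 w wᵖ≅𝟙 = begin
      w        ≡⟨ w≡x⊕𝟙 ⟩
      x ⊕ 𝟙    ≈⟨ ⊕-cong x≅𝟘 (≅-mod-refl {x = 𝟙}) ⟩
      𝟘 ⊕ 𝟙    ≡⟨ ⊕-identityˡ 𝟙 ⟩
      𝟙        ∎
      where
      open ≅-mod-Reasoning (+ p)
      x : ℤ[θ]
      x = w ⊕ (0ℤ θ+ - 1ℤ)
      w≡x⊕𝟙 : w ≡ x ⊕ 𝟙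
      w≡x⊕𝟙 = sym (trans (⊕-assoc w _ 𝟙) (⊕-identityʳ w))
      xᵖ⊕𝟙≅𝟘⊕𝟙 : x ⊛^ p ⊕ 𝟙 ≅ 𝟘 ⊕ 𝟙 ⟨mod + p ⟩
      xᵖ⊕𝟙≅𝟘⊕𝟙 = ≅-mod-trans (≅-mod-sym (frobenius p-prime x))
                    (subst (λ y → y ⊛^ p ≅ 𝟘 ⊕ 𝟙 ⟨mod + p ⟩) w≡x⊕𝟙 (≅-mod-trans wᵖ≅𝟙 (≡⇒≅-mod (sym (⊕-identityˡ 𝟙)))))
      x≅𝟘 : x ≅ 𝟘 ⟨mod + p ⟩
      x≅𝟘 = ⊛^p≅𝟘⇒≅𝟘 p-prime p∤disc x (⊕-cancelʳ 𝟙 xᵖ⊕𝟙≅𝟘⊕𝟙)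

    -- Strong induction: if p ∣ m then w^(m/p) already satisfies the hypothesis.
    ⊛^≅𝟙⇒coprime-order : ∀ w m → 0 ℕ.< m → w ⊛^ m ≅ 𝟙 ⟨mod + p ⟩ →
                          ∃ λ m′ → ¬ (p ℕ.∣ m′) × w ⊛^ m′ ≅ 𝟙 ⟨mod + p ⟩
    ⊛^≅𝟙⇒coprime-order w = <-rec Reduces step
      where
      Reduces : ℕ → Set
      Reduces m = 0 ℕ.< m → w ⊛^ m ≅ 𝟙 ⟨mod + p ⟩ → ∃ λ m′ → ¬ (p ℕ.∣ m′) × w ⊛^ m′ ≅ 𝟙 ⟨mod + p ⟩
      step : ∀ m → (∀ {m′} → m′ ℕ.< m → Reduces m′) → Reduces m
      step m rec 0<m wᵐ≅𝟙 with p ℕ.∣? m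
      ... | no p∤m = m , p∤m , wᵐ≅𝟙
      ... | yes (ℕ.divides q refl) = rec q<qp 0<q (⊛^p≅𝟙⇒≅𝟙 (w ⊛^ q) (≅-mod-trans (≡⇒≅-mod (⊛^-*-assoc w q p)) wᵐ≅𝟙))
        where
        0<q : 0 ℕ.< q
        0<q = ℕₚ.n≢0⇒n>0 λ { refl → ℕₚ.<-irrefl refl 0<m }
        q<qp : q ℕ.< q ℕ.* p
        q<qp = ℕₚ.m<m*n q p {{ℕ.>-nonZero 0<q}} (ℕ.nonTrivial⇒n>1 p {{prime⇒nonTrivial p-prime}})


  module _ {k : ℤ} {w w′ : ℤ[θ]} (w′w≅𝟙 : w′ ⊛ w ≅ 𝟙 ⟨mod k ⟩) where

    w′ⁱwⁱ≅𝟙 : ∀ i → w′ ⊛^ i ⊛ w ⊛^ i ≅ 𝟙 ⟨mod k ⟩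
    w′ⁱwⁱ≅𝟙 i = begin
      w′ ⊛^ i ⊛ w ⊛^ i    ≡⟨ ⊛^-distribʳ-⊛ w′ w i ⟨
      (w′ ⊛ w) ⊛^ i        ≈⟨ ⊛^-cong i w′w≅𝟙 ⟩
      𝟙 ⊛^ i               ≡⟨ 𝟙⊛^n≡𝟙 i ⟩
      𝟙                    ∎
      where open ≅-mod-Reasoning k

    ⊛^-cancel : ∀ i j → w ⊛^ i ≅ w ⊛^ (i ℕ.+ j) ⟨mod k ⟩ → w ⊛^ j ≅ 𝟙 ⟨mod k ⟩
    ⊛^-cancel i j wⁱ≅wⁱ⁺ʲ = begin
      w ⊛^ j                          ≡⟨ ⊛-identityˡ (w ⊛^ j) ⟨
      𝟙 ⊛ w ⊛^ j                      ≈⟨ ⊛-cong (≅-mod-sym (w′ⁱwⁱ≅𝟙 i)) (≅-mod-refl {x = w ⊛^ j}) ⟩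
      w′ ⊛^ i ⊛ w ⊛^ i ⊛ w ⊛^ j       ≡⟨ ⊛-assoc (w′ ⊛^ i) (w ⊛^ i) (w ⊛^ j) ⟩
      w′ ⊛^ i ⊛ (w ⊛^ i ⊛ w ⊛^ j)     ≡⟨ cong (w′ ⊛^ i ⊛_) (⊛^-distribˡ-+-⊛ w i j) ⟨
      w′ ⊛^ i ⊛ w ⊛^ (i ℕ.+ j)        ≈⟨ ⊛-cong (≅-mod-refl {x = w′ ⊛^ i}) (≅-mod-sym wⁱ≅wⁱ⁺ʲ) ⟩
      w′ ⊛^ i ⊛ w ⊛^ i                ≈⟨ w′ⁱwⁱ≅𝟙 i ⟩
      𝟙                               ∎
      where open ≅-mod-Reasoning k

  module _ {p} .{{_ : NonZero p}} where

    residues : ℤ[θ] → Fin (p ℕ.* p)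
    residues (a θ+ b) = combine (residue a) (residue b)

    residues-≅ : ∀ {x y} → residues x ≡ residues y → x ≅ y ⟨mod + p ⟩
    residues-≅ {a θ+ b} {a′ θ+ b′} eq with Finₚ.combine-injective (residue a) (residue b) (residue a′) (residue b′) eq
    ... | ≡a , ≡b = componentwise (residue-≡-mod a a′ ≡a) (residue-≡-mod b b′ ≡b)

    -- Pigeonhole on the residues of 𝟙, w, …, w^(p²).
    invertible⇒finite-order : ∀ w w′ → w′ ⊛ w ≅ 𝟙 ⟨mod + p ⟩ → ∃ λ m → 0 ℕ.< m × w ⊛^ m ≅ 𝟙 ⟨mod + p ⟩
    invertible⇒finite-order w w′ w′w≅𝟙
      with i , j , i<j , same ← Finₚ.pigeonhole (ℕₚ.n<1+n (p ℕ.* p)) (λ i → residues (w ⊛^ toℕ i))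
      with o , i+1+o≡j ← ℕₚ.m≤n⇒∃[o]m+o≡n i<j
      = suc o , s≤s z≤n , ⊛^-cancel {w = w} {w′} w′w≅𝟙 (toℕ i) (suc o) (≅-mod-trans (residues-≅ same)
                            (≡⇒≅-mod (cong (w ⊛^_) (trans (sym i+1+o≡j) (sym (ℕₚ.+-suc (toℕ i) o))))))

tr disc : M2 → ℤ
tr g = a g + d g
disc g = tr g * tr g - + 4 * det g

-- θ ↦ X is well defined because X² = (tr X) X − (det X) I₂ (Cayley–Hamilton).
module Embedding (xa xb xc xd : ℤ) where
  X : M2
  X = mat xa xb xc xd
  open QuadraticRing (tr X) (det X) public

  embed : ℤ[θ] → M2
  embed (α θ+ β) = mat (α * xa + β) (α * xb) (α * xc) (α * xd + β)

  embed-⊛ : ∀ x y → embed (x ⊛ y) ≡ embed x ⊗ embed y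
  embed-⊛ (α θ+ β) (γ θ+ δ) =
    mat-cong (a-entry α β γ δ xa xb xc xd) (b-entry α β γ δ xa xb xc xd)
             (c-entry α β γ δ xa xb xc xd) (d-entry α β γ δ xa xb xc xd)
    where
    a-entry : ∀ α β γ δ xa xb xc xd →
      (α * δ + β * γ + α * γ * (xa + xd)) * xa + (β * δ - α * γ * (xa * xd - xb * xc))
      ≡ (α * xa + β) * (γ * xa + δ) + (α * xb) * (γ * xc)
    a-entry = solve-∀
    b-entry : ∀ α β γ δ xa xb xc xd →
      (α * δ + β * γ + α * γ * (xa + xd)) * xb ≡ (α * xa + β) * (γ * xb) + (α * xb) * (γ * xd + δ)
    b-entry = solve-∀
    c-entry : ∀ α β γ δ xa xb xc xd →
      (α * δ + β * γ + α * γ * (xa + xd)) * xc ≡ (α * xc) * (γ * xa + δ) + (α * xd + β) * (γ * xc)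
    c-entry = solve-∀
    d-entry : ∀ α β γ δ xa xb xc xd →
      (α * δ + β * γ + α * γ * (xa + xd)) * xd + (β * δ - α * γ * (xa * xd - xb * xc))
      ≡ (α * xc) * (γ * xb) + (α * xd + β) * (γ * xd + δ)
    d-entry = solve-∀

  embed-𝟙 : embed 𝟙 ≡ I₂
  embed-𝟙 = mat-cong (diagonal xa) (off-diagonal xb) (off-diagonal xc) (diagonal xd)
    where
    diagonal : ∀ x → 0ℤ * x + 1ℤ ≡ 1ℤ
    diagonal = solve-∀
    off-diagonal : ∀ x → 0ℤ * x ≡ 0ℤ
    off-diagonal = solve-∀

  embed-θ : embed θ ≡ X
  embed-θ = mat-cong (diagonal xa) (off-diagonal xb) (off-diagonal xc) (diagonal xd)
    where
    diagonal : ∀ x → 1ℤ * x + 0ℤ ≡ x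
    diagonal = solve-∀
    off-diagonal : ∀ x → 1ℤ * x ≡ x
    off-diagonal = solve-∀

  embed-θ⊛^ : ∀ n → embed (θ ⊛^ n) ≡ X ^ᴹ n
  embed-θ⊛^ zero    = embed-𝟙
  embed-θ⊛^ (suc n) = trans (embed-⊛ θ (θ ⊛^ n)) (cong₂ _⊗_ embed-θ (embed-θ⊛^ n))

  embed-cong : ∀ {k x y} → x ≅ y ⟨mod k ⟩ → embed x ≋ embed y ⟨mod k ⟩
  embed-cong {x = _ θ+ _} {_ θ+ _} (componentwise ≡α ≡β) =
    entrywise (+-cong (*-congʳ xa ≡α) ≡β) (*-congʳ xb ≡α) (*-congʳ xc ≡α) (+-cong (*-congʳ xd ≡α) ≡β)


  θ⁻¹⊛θ≅𝟙 : ∀ {k} e → det X * e ≡ 1ℤ ⟨mod k ⟩ → (- e θ+ tr X * e) ⊛ θ ≅ 𝟙 ⟨mod k ⟩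
  θ⁻¹⊛θ≅𝟙 e de≡1 =
    componentwise (≡⇒≡-mod (θ-part e (tr X))) (≡-mod-trans (≡⇒≡-mod (constant-part e (tr X) (det X))) de≡1)
    where
    θ-part : ∀ e t → - e * 0ℤ + t * e * 1ℤ + - e * 1ℤ * t ≡ 0ℤ
    θ-part = solve-∀
    constant-part : ∀ e t d → t * e * 0ℤ - - e * 1ℤ * d ≡ d * e
    constant-part = solve-∀

  X^ᴹ-coprime-order : ∀ {p} → Prime p → ∀ e → det X * e ≡ 1ℤ ⟨mod + p ⟩ → ¬ (+ p ∣ disc X) →
                      ∃ λ m → ¬ (p ℕ.∣ m) × X ^ᴹ m ≋ I₂ ⟨mod + p ⟩
  X^ᴹ-coprime-order {p} p-prime e de≡1 p∤disc =
    let m , 0<m , θᵐ≅𝟙 = invertible⇒finite-order {{prime⇒nonZero p-prime}} θ (- e θ+ tr X * e) (θ⁻¹⊛θ≅𝟙 e de≡1)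
        m′ , p∤m′ , θᵐ′≅𝟙 = ⊛^≅𝟙⇒coprime-order p-prime p∤disc θ m 0<m θᵐ≅𝟙
    in m′ , p∤m′ , (begin
         X ^ᴹ m′             ≡⟨ embed-θ⊛^ m′ ⟨
         embed (θ ⊛^ m′)     ≈⟨ embed-cong θᵐ′≅𝟙 ⟩
         embed 𝟙             ≡⟨ embed-𝟙 ⟩
         I₂                  ∎)
    where open ≋-mod-Reasoning (+ p)

semisimple⇒coprime-order : ∀ {p} → Prime p → ∀ X → ¬ (+ p ∣ det X) → ¬ (+ p ∣ disc X) →
                           ∃ λ m → ¬ (p ℕ.∣ m) × X ^ᴹ m ≋ I₂ ⟨mod + p ⟩
semisimple⇒coprime-order p-prime X@(mat xa xb xc xd) p∤det =
  let e , de≡1 = invertible-mod-prime p-prime (det X) p∤det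
  in Embedding.X^ᴹ-coprime-order xa xb xc xd p-prime e de≡1

-- Squares modulo an odd number

even⊎odd : ∀ n → ∃ λ h → n ≡ h ℕ.+ h ⊎ n ≡ suc (h ℕ.+ h)
even⊎odd zero = 0 , inj₁ refl
even⊎odd (suc n) with even⊎odd n
... | h , inj₁ refl = h , inj₂ refl
... | h , inj₂ refl = suc h , inj₁ (cong suc (sym (ℕₚ.+-suc h h)))

prime>2⇒odd : ∀ {p} → Prime p → 2 ℕ.< p → ∃ λ h → p ≡ suc (h ℕ.+ h)
prime>2⇒odd {p} p-prime 2<p with even⊎odd p
... | h , inj₂ p≡2h+1 = h , p≡2h+1
... | h , inj₁ p≡2h with prime⇒irreducible p-prime (ℕ.divides h (trans p≡2h (trans (cong (h ℕ.+_) (sym (ℕₚ.+-identityʳ h))) (ℕₚ.*-comm 2 h))))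
...   | inj₂ refl = ⊥-elim (ℕₚ.<-irrefl refl 2<p)

pos-∸ : ∀ {m n} → n ℕ.≤ m → + (m ∸ n) ≡ + m - + n
pos-∸ {m} {n} n≤m = trans (sym (ℤₚ.⊖-≥ n≤m)) (sym (ℤₚ.m-n≡m⊖n m n))

≤∧≡-mod⇒≡ : ∀ {n a b} → a ℕ.≤ b → b ℕ.< n → + a ≡ + b ⟨mod + n ⟩ → a ≡ b
≤∧≡-mod⇒≡ {n} {a} {b} a≤b b<n a≡b =
  ℕₚ.≤-antisym a≤b (ℕₚ.m∸n≡0⇒m≤n (small-multiple (b ∸ a) (ℕₚ.≤-<-trans (ℕₚ.m∸n≤m b a) b<n)
    (∣⇒∣ᵤ (subst (+ n ∣_) (sym (pos-∸ a≤b)) (∣-difference (≡-mod-sym a≡b))))))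
  where
  small-multiple : ∀ m → m ℕ.< n → n ℕ.∣ m → m ≡ 0
  small-multiple zero    _   _   = refl
  small-multiple (suc m) m<n n∣m = ⊥-elim (ℕ.>⇒∤ m<n n∣m)

≡-mod-<⇒≡ : ∀ {n a b} → a ℕ.< n → b ℕ.< n → + a ≡ + b ⟨mod + n ⟩ → a ≡ b
≡-mod-<⇒≡ {a = a} {b} a<n b<n a≡b =
  [ (λ a≤b → ≤∧≡-mod⇒≡ a≤b b<n a≡b) , (λ b≤a → sym (≤∧≡-mod⇒≡ b≤a a<n (≡-mod-sym a≡b))) ]′ (ℕₚ.≤-total a b)

IsSquare : ∀ n → Fin n → Set
IsSquare n y = ∃ λ (r : Fin n) → + toℕ r * + toℕ r ≡ + toℕ y ⟨mod + n ⟩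

NonSquare : ℕ → ℤ → Set
NonSquare n D = ∀ r → ¬ (r * r ≡ D ⟨mod + n ⟩)

isSquare? : ∀ n y → Dec (IsSquare n y)
isSquare? n y = Finₚ.any? λ r → ≡-mod? (+ n) (+ toℕ r * + toℕ r) (+ toℕ y)

module OddModulus (h : ℕ) where

  n : ℕ
  n = suc (h ℕ.+ h)

  -- r and n − r have the same square, and one of them is at most h.
  small-root : ∀ (r : Fin n) → ∃ λ (s : Fin (suc h)) → + toℕ s * + toℕ s ≡ + toℕ r * + toℕ r ⟨mod + n ⟩
  small-root r = choose (toℕ r ℕₚ.≤? h)
    where
    R : ℤ
    R = + toℕ r
    choose : Dec (toℕ r ℕ.≤ h) → ∃ λ (s : Fin (suc h)) → + toℕ s * + toℕ s ≡ R * R ⟨mod + n ⟩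
    choose (yes r≤h) = fromℕ< (s≤s r≤h) , ≡⇒≡-mod (cong (λ x → + x * + x) (Finₚ.toℕ-fromℕ< (s≤s r≤h)))
    choose (no  r≰h) = fromℕ< (s≤s n∸r≤h) , (begin
      + toℕ (fromℕ< (s≤s n∸r≤h)) * + toℕ (fromℕ< (s≤s n∸r≤h))
        ≡⟨ cong (λ x → + x * + x) (Finₚ.toℕ-fromℕ< (s≤s n∸r≤h)) ⟩
      + (n ∸ toℕ r) * + (n ∸ toℕ r)
        ≡⟨ cong (λ x → x * x) (pos-∸ (ℕₚ.<⇒≤ (Finₚ.toℕ<n r))) ⟩
      (+ n - R) * (+ n - R)
        ≈⟨ ≡-mod-by (expand (+ n) R) (∣m⇒∣m*n (+ n - R - R) ∣-refl) ⟩
      R * R ∎)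
      where
      open ≡-mod-Reasoning (+ n)
      n∸r≤h : n ∸ toℕ r ℕ.≤ h
      n∸r≤h = ℕₚ.≤-trans (ℕₚ.∸-monoʳ-≤ n (ℕₚ.≰⇒> r≰h)) (ℕₚ.≤-reflexive (ℕₚ.m+n∸n≡m h h))
      expand : ∀ n r → (n - r) * (n - r) - r * r ≡ n * (n - r - r)
      expand = solve-∀

  -- The squares are the squares of 0, …, h, which are fewer than n residues.
  ¬all-squares : 0 ℕ.< h → ¬ (∀ y → IsSquare n y)
  ¬all-squares 0<h square = ℕₚ.<⇒≱ n>h+1 (Finₚ.injective⇒≤ root-injective)
    where
    n>h+1 : suc h ℕ.< n
    n>h+1 = s≤s (ℕₚ.m<m+n h 0<h)
    root : Fin n → Fin (suc h)
    root y = proj₁ (small-root (proj₁ (square y)))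
    root² : ∀ y → + toℕ (root y) * + toℕ (root y) ≡ + toℕ y ⟨mod + n ⟩
    root² y = ≡-mod-trans (proj₂ (small-root (proj₁ (square y)))) (proj₂ (square y))
    root-injective : Injective _≡_ _≡_ root
    root-injective {y} {y′} eq = Finₚ.toℕ-injective (≡-mod-<⇒≡ (Finₚ.toℕ<n y) (Finₚ.toℕ<n y′)
      (≡-mod-trans (≡-mod-sym (root² y))
        (subst (λ s → + toℕ s * + toℕ s ≡ + toℕ y′ ⟨mod + n ⟩) (sym eq) (root² y′))))

  ∃-nonsquare : 0 ℕ.< h → ∃ (NonSquare n)
  ∃-nonsquare 0<h =
    let y , ¬square = Finₚ.¬∀⟶∃¬ n (IsSquare n) (isSquare? n) (¬all-squares 0<h)
    in + toℕ y , λ r r²≡y → ¬square (residue r , ≡-mod-trans (*-cong (residue≡x r) (residue≡x r)) r²≡y)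

  -- With w = h + 1 we have 2w ≡ 1, so that (w t)² − det X ≡ w² (t² − 4 det X).
  ≡nonsquare⇒∤disc : ∀ {D} → NonSquare n D →
                     ∀ X → det X ≡ D ⟨mod + n ⟩ → ¬ (+ n ∣ disc X)
  ≡nonsquare⇒∤disc {D} nonsquare X det≡D n∣disc = nonsquare (tr X * w) (≡-mod-by identity
      (∣m∣n⇒∣m+n (∣m∣n⇒∣m+n (∣n⇒∣m*n (w * w) n∣disc) (∣m⇒∣m*n (det X) (∣m⇒∣m*n (w + w + 1ℤ) ∣-refl)))
                 (∣-difference det≡D)))
    where
    w : ℤ
    w = + suc h
    n≡2w-1 : + n ≡ w + w - 1ℤ
    n≡2w-1 = trans (ℤₚ.pos-+ 1 (h ℕ.+ h)) (trans (cong (λ x → 1ℤ + x) (ℤₚ.pos-+ h h)) (regroup (+ h)))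
      where
      regroup : ∀ h → 1ℤ + (h + h) ≡ (1ℤ + h) + (1ℤ + h) - 1ℤ
      regroup = solve-∀
    expand : ∀ t w δ D → (t * w) * (t * w) - D
             ≡ w * w * (t * t - + 4 * δ) + (w + w - 1ℤ) * (w + w + 1ℤ) * δ + (δ - D)
    expand = solve-∀
    identity : (tr X * w) * (tr X * w) - D ≡ w * w * disc X + + n * (w + w + 1ℤ) * det X + (det X - D)
    identity = trans (expand (tr X) w (det X) D)
                     (cong (λ m → w * w * disc X + m * (w + w + 1ℤ) * det X + (det X - D)) (sym n≡2w-1))

-- Subgroups of GL₂(ℤ/pᵉℤ) with surjective determinant

[mod]⇒⟨mod^⟩ : ∀ {m e x y} → x ≡ y [mod m ℕ.^ e ] → x ≡ y ⟨mod (+ m) ^ e ⟩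
[mod]⇒⟨mod^⟩ {m} {e} {x} {y} x≡y = subst (λ k → x ≡ y ⟨mod k ⟩) (pos-^ m e) ([mod]⇒⟨mod⟩ x≡y)

⟨mod^⟩⇒[mod] : ∀ {m e x y} → x ≡ y ⟨mod (+ m) ^ e ⟩ → x ≡ y [mod m ℕ.^ e ]
⟨mod^⟩⇒[mod] {m} {e} {x} {y} x≡y = ⟨mod⟩⇒[mod] (subst (λ k → x ≡ y ⟨mod k ⟩) (sym (pos-^ m e)) x≡y)

⟨mod^⟩⇒≋[mod] : ∀ {m e g h} → g ≋ h ⟨mod (+ m) ^ e ⟩ → g ≋ h [mod m ℕ.^ e ]
⟨mod^⟩⇒≋[mod] {m} {e} {g} {h} g≋h = ⟨mod⟩⇒≋[mod] (subst (λ k → g ≋ h ⟨mod k ⟩) (sym (pos-^ m e)) g≋h)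

y≡1⇒y*z≡1⇒z≡1 : ∀ {k y z} → y ≡ 1ℤ ⟨mod k ⟩ → y * z ≡ 1ℤ ⟨mod k ⟩ → z ≡ 1ℤ ⟨mod k ⟩
y≡1⇒y*z≡1⇒z≡1 {k} {y} {z} y≡1 yz≡1 = begin
  z         ≡⟨ ℤₚ.*-identityˡ z ⟨
  1ℤ * z    ≈⟨ *-congʳ z (≡-mod-sym y≡1) ⟩
  y * z     ≈⟨ yz≡1 ⟩
  1ℤ        ∎
  where open ≡-mod-Reasoning k

det-⊗-≡ : ∀ {k} B A {y z} → det B ≡ y ⟨mod k ⟩ → det A ≡ z ⟨mod k ⟩ → det (B ⊗ A) ≡ y * z ⟨mod k ⟩
det-⊗-≡ B A detB≡y detA≡z = ≡-mod-trans (≡⇒≡-mod (det-⊗ B A)) (*-cong detB≡y detA≡z)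

module OddPrime {p : ℕ} (p-prime : Prime p) (2<p : 2 ℕ.< p) where

  -- det g − 1 then has p-adic valuation exactly k + 1
  ExactLevel : ℕ → M2 → Set
  ExactLevel k g = g ≋ I₂ ⟨mod (+ p) ^ suc k ⟩ × ¬ det g ≡ 1ℤ ⟨mod (+ p) ^ suc (suc k) ⟩

  ExactLevel-^p : ∀ {k g} → ExactLevel k g → ExactLevel (suc k) (g ^ᴹ p)
  ExactLevel-^p {k} {g} (g≋I₂ , det≢1) =
    ^ᴹ-≋I₂ p g p∣pᵏ⁺¹ g≋I₂ ,
    λ detgᵖ≡1 → ≢1⇒^p≢1 p-prime 2<p p∣pᵏ⁺¹ (det-cong g≋I₂) det≢1
                  (subst (λ y → y ≡ 1ℤ ⟨mod (+ p) ^ suc (suc (suc k)) ⟩) (det-^ᴹ g p) detgᵖ≡1)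
    where
    p∣pᵏ⁺¹ : + p ∣ (+ p) ^ suc k
    p∣pᵏ⁺¹ = ∣m⇒∣m*n ((+ p) ^ k) ∣-refl

  ExactLevel-^p^k : ∀ {g} k → ExactLevel 0 g → ExactLevel k (g ^ᴹ (p ℕ.^ k))
  ExactLevel-^p^k {g} zero    g-exact = subst (ExactLevel 0) (sym (⊗-identityʳ g)) g-exact
  ExactLevel-^p^k {g} (suc k) g-exact =
    subst (ExactLevel (suc k)) (trans (^ᴹ-*-assoc g (p ℕ.^ k) p) (cong (g ^ᴹ_) (ℕₚ.*-comm (p ℕ.^ k) p)))
          (ExactLevel-^p {k} (ExactLevel-^p^k k g-exact))

  private
    odd : ∃ λ h → p ≡ suc (h ℕ.+ h)
    odd = prime>2⇒odd p-prime 2<p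
    h : ℕ
    h = proj₁ odd
    module Odd = OddModulus h
    as-p : (P : ℕ → Set) → P Odd.n → P p
    as-p P = subst P (sym (proj₂ odd))
    0<h : 0 ℕ.< h
    0<h = ℕₚ.n≢0⇒n>0 λ h≡0 →
      ℕₚ.<⇒≱ 2<p (ℕₚ.≤-trans (ℕₚ.≤-reflexive (trans (proj₂ odd) (cong (λ x → suc (x ℕ.+ x)) h≡0))) (s≤s z≤n))

  D : ℤ
  D = proj₁ (as-p (λ n → ∃ (NonSquare n)) (Odd.∃-nonsquare 0<h))

  D-nonsquare : NonSquare p D
  D-nonsquare = proj₂ (as-p (λ n → ∃ (NonSquare n)) (Odd.∃-nonsquare 0<h))

  p∤D : ¬ (+ p ∣ D)
  p∤D p∣D = D-nonsquare 0ℤ (≡-mod-sym (∣⇒≡-mod-0 p∣D))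

  det≡D⇒coprime-order : ∀ X → det X ≡ D ⟨mod + p ⟩ → ∃ λ m → ¬ (p ℕ.∣ m) × X ^ᴹ m ≋ I₂ ⟨mod + p ⟩
  det≡D⇒coprime-order X det≡D = semisimple⇒coprime-order p-prime X p∤det p∤disc
    where
    p∤det : ¬ (+ p ∣ det X)
    p∤det p∣det = p∤D (≡-mod-0⇒∣ (≡-mod-trans (≡-mod-sym det≡D) (∣⇒≡-mod-0 p∣det)))
    p∤disc : ¬ (+ p ∣ disc X)
    p∤disc = as-p (λ n → ∀ {D} → NonSquare n D → ∀ X → det X ≡ D ⟨mod + n ⟩ → ¬ (+ n ∣ disc X))
                  Odd.≡nonsquare⇒∤disc D-nonsquare X det≡D

  module _ (k : ℕ) {H : M2 → Set} (subgroup : IsSubgroupGL2 (p ℕ.^ suc (suc k)) H)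
           (det-surjective : ∀ u → IsUnit (p ℕ.^ suc (suc k)) u →
                             ∃ λ g → H g × det g ≡ u [mod p ℕ.^ suc (suc k) ]) where
    open IsSubgroupGL2 subgroup using (mulClosed)

    private
      q : ℤ
      q = (+ p) ^ suc (suc k)
      p²∣q : (+ p) ^ 2 ∣ q
      p²∣q = ^-monoʳ-∣ (+ p) {2} {suc (suc k)} (s≤s (s≤s z≤n))
      p∣q : + p ∣ q
      p∣q = ∣m⇒∣m*n ((+ p) ^ suc k) ∣-refl

    det-hits : ∀ u → ¬ (+ p ∣ u) → ∃ λ g → H g × det g ≡ u ⟨mod q ⟩
    det-hits u p∤u =
      let v , uv≡1    = invertible-mod-prime p-prime u p∤u
          w , uw≡1    = invertible-mod-^ u v uv≡1 (suc (suc k))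
          g , Hg , det≡u = det-surjective u (w , ⟨mod^⟩⇒[mod] {p} {suc (suc k)} uw≡1)
      in g , Hg , [mod]⇒⟨mod^⟩ {p} {suc (suc k)} det≡u

    -- Powers of B and of B A with exponent prime to p that are ≡ I₂ modulo p; their determinants
    -- differ by (det A)ᴹ ≡ 1 + M p, so one of them is ≢ 1 modulo p².
    base-element-from : ∀ {B A} → H B → H A → det A ≡ 1ℤ + + p ⟨mod (+ p) ^ 2 ⟩ →
                        (∃ λ m → ¬ (p ℕ.∣ m) × B ^ᴹ m ≋ I₂ ⟨mod + p ⟩) →
                        (∃ λ m → ¬ (p ℕ.∣ m) × (B ⊗ A) ^ᴹ m ≋ I₂ ⟨mod + p ⟩) →
                        ∃ λ g → H g × ExactLevel 0 g
    base-element-from {B} {A} HB HA detA≡1+p (m₁ , p∤m₁ , Bᵐ¹≋I₂) (m₂ , p∤m₂ , BAᵐ²≋I₂) =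
      choose (≡-mod? ((+ p) ^ 2) (det Z₁) 1ℤ)
      where
      M : ℕ
      M = m₁ ℕ.* m₂
      Z₁ Z₂ : M2
      Z₁ = B ^ᴹ M
      Z₂ = (B ⊗ A) ^ᴹ M
      p∤M : ¬ (p ℕ.∣ M)
      p∤M p∣M = [ p∤m₁ , p∤m₂ ]′ (euclidsLemma m₁ m₂ p-prime p∣M)
      p¹∣p : (+ p) ^ 1 ∣ + p
      p¹∣p = ∣-reflexive (ℤₚ.^-identityʳ (+ p))
      Z₁≋I₂ : Z₁ ≋ I₂ ⟨mod (+ p) ^ 1 ⟩
      Z₁≋I₂ = ≋-mod-∣ p¹∣p (subst (λ g → g ≋ I₂ ⟨mod + p ⟩) (^ᴹ-*-assoc B m₁ m₂) (≋I₂⇒^ᴹ≋I₂ m₂ Bᵐ¹≋I₂))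
      Z₂≋I₂ : Z₂ ≋ I₂ ⟨mod (+ p) ^ 1 ⟩
      Z₂≋I₂ = ≋-mod-∣ p¹∣p (subst (λ g → g ≋ I₂ ⟨mod + p ⟩)
                                 (trans (^ᴹ-*-assoc (B ⊗ A) m₂ m₁) (cong ((B ⊗ A) ^ᴹ_) (ℕₚ.*-comm m₂ m₁)))
                                 (≋I₂⇒^ᴹ≋I₂ m₁ BAᵐ²≋I₂))
      detZ₂≡detZ₁*detAᴹ : det Z₂ ≡ det Z₁ * det A ^ M
      detZ₂≡detZ₁*detAᴹ = trans (det-^ᴹ (B ⊗ A) M) (trans (cong (_^ M) (det-⊗ B A))
                                (trans (^-distribʳ-* (det B) (det A) M) (cong (_* det A ^ M) (sym (det-^ᴹ B M)))))
      p²≡pp : (+ p) ^ 2 ≡ + p * + p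
      p²≡pp = cong (+ p *_) (ℤₚ.*-identityʳ (+ p))
      detAᴹ≢1 : ¬ det A ^ M ≡ 1ℤ ⟨mod (+ p) ^ 2 ⟩
      detAᴹ≢1 detAᴹ≡1 = p∤M (∣⇒∣ᵤ (*-cancelʳ-∣ (+ p) {+ p} {+ M} {{prime⇒nonZero p-prime}} pp∣Mp))
        where
        1+Mp≡1 : 1ℤ + + M * + p ≡ 1ℤ ⟨mod (+ p) ^ 2 ⟩
        1+Mp≡1 = ≡-mod-trans (≡-mod-sym (≡-mod-trans (^-cong M detA≡1+p)
                                          (≡-mod-∣ (∣-reflexive p²≡pp) ([1+y]^j≡1+jy (+ p) M))))
                             detAᴹ≡1
        cancel : ∀ w → 1ℤ + w - 1ℤ ≡ w
        cancel = solve-∀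
        pp∣Mp : + p * + p ∣ + M * + p
        pp∣Mp = ∣-trans (∣-reflexive (sym p²≡pp)) (subst ((+ p) ^ 2 ∣_) (cancel (+ M * + p)) (∣-difference 1+Mp≡1))
      choose : Dec (det Z₁ ≡ 1ℤ ⟨mod (+ p) ^ 2 ⟩) → ∃ λ g → H g × ExactLevel 0 g
      choose (no  detZ₁≢1) = Z₁ , ^ᴹ-closed subgroup M HB , Z₁≋I₂ , detZ₁≢1
      choose (yes detZ₁≡1) = Z₂ , ^ᴹ-closed subgroup M (mulClosed HB HA) , Z₂≋I₂ ,
        λ detZ₂≡1 → detAᴹ≢1 (y≡1⇒y*z≡1⇒z≡1 detZ₁≡1 (subst (λ y → y ≡ 1ℤ ⟨mod (+ p) ^ 2 ⟩) detZ₂≡detZ₁*detAᴹ detZ₂≡1))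

    base-element : ∃ λ g → H g × ExactLevel 0 g
    base-element =
      let B , HB , detB≡D   = det-hits D p∤D
          A , HA , detA≡1+p = det-hits (1ℤ + + p) p∤1+p
          detB≡D′   = ≡-mod-∣ p∣q detB≡D
          detA≡1+p′ = ≡-mod-∣ p²∣q detA≡1+p
          detBA≡D   = ≡-mod-trans (det-⊗-≡ B A detB≡D′ (≡-mod-trans (≡-mod-∣ p∣q detA≡1+p) 1+p≡1))
                                  (≡⇒≡-mod (ℤₚ.*-identityʳ D))
      in base-element-from HB HA detA≡1+p′ (det≡D⇒coprime-order B detB≡D′)
                                           (det≡D⇒coprime-order (B ⊗ A) detBA≡D)
      where
      p∤1+p : ¬ (+ p ∣ 1ℤ + + p)
      p∤1+p p∣1+p = ℕₚ.<⇒≢ (ℕₚ.<-trans (s≤s (s≤s z≤n)) 2<p) (sym (ℕ.∣1⇒≡1 (∣⇒∣ᵤ (∣m+n∣n⇒∣m {+ p} {1ℤ} p∣1+p ∣-refl))))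
      1+p≡1 : 1ℤ + + p ≡ 1ℤ ⟨mod + p ⟩
      1+p≡1 = subst (λ z → 1ℤ + z ≡ 1ℤ ⟨mod + p ⟩) (ℤₚ.*-identityˡ (+ p)) (x+y*k≡x 1ℤ 1ℤ)

    det-surjective-on-kernel : ∀ x → x ≡ 1ℤ ⟨mod (+ p) ^ suc k ⟩ →
                               ∃ λ g → H g × g ≋ I₂ ⟨mod (+ p) ^ suc k ⟩ × det g ≡ x ⟨mod q ⟩
    det-surjective-on-kernel x x≡1 =
      let g , Hg , g-exact = base-element
          g′ = g ^ᴹ (p ℕ.^ k)
          g′≋I₂ , detg′≢1 = ExactLevel-^p^k k g-exact
          j , detg′ʲ≡x = ^-hits-1+q p-prime (∣m⇒∣m*n ((+ p) ^ k) ∣-refl) (det-cong g′≋I₂) detg′≢1 x≡1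
      in g′ ^ᴹ j , ^ᴹ-closed subgroup j (^ᴹ-closed subgroup (p ℕ.^ k) Hg) , ≋I₂⇒^ᴹ≋I₂ j g′≋I₂ ,
         subst (λ y → y ≡ x ⟨mod q ⟩) (sym (det-^ᴹ g′ j)) detg′ʲ≡x

lemma2p5 : (n p : ℕ) → 1 ℕ.≤ n → Prime p → 3 ℕ.≤ p →
    (H : M2 → Set) → IsSubgroupGL2 (p ℕ.^ suc n) H →
    (∀ (u : ℤ) → IsUnit (p ℕ.^ suc n) u →
      ∃ λ g → H g × det g ≡ u [mod p ℕ.^ suc n ]) →
    ∀ (x : ℤ) → x ≡ 1ℤ [mod p ℕ.^ n ] →
      ∃ λ g → H g × g ≋ I₂ [mod p ℕ.^ n ] × det g ≡ x [mod p ℕ.^ suc n ]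
lemma2p5 (suc k) p _ p-prime 3≤p H subgroup det-surjective x x≡1 =
  let g , Hg , g≋I₂ , detg≡x =
        OddPrime.det-surjective-on-kernel p-prime 3≤p k subgroup det-surjective x ([mod]⇒⟨mod^⟩ {p} {suc k} x≡1)
  in g , Hg , ⟨mod^⟩⇒≋[mod] {p} {suc k} g≋I₂ , ⟨mod^⟩⇒[mod] {p} {suc (suc k)} detg≡x
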